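{- Let $C$ be an $\mathbb{F}_q$-$[n\times m,k]$ rank-metric code and let $\mathcal{M}=\mathcal{M}[C]$. Then the number of $t$-tuples of bilinear forms $(b_1,\ldots,b_t)$ induced by $C$ that distinguish $\operatorname{supp}(C)$ is $\mathbb{P}(\mathcal{M}.\operatorname{supp}(C);q^t)$. In particular, if $C$ is non-degenerate then this number is $\mathbb{P}(\mathcal{M};q^t)$.
   Context: $q$ is a prime power, $E=\mathbb{F}_q^n$, $\mathcal{L}(E)$ is the lattice of subspaces of $E$, with Möbius function $\mu(V,W)=(-1)^{d}q^{\binom{d}{2}}$ ($d=\dim W-\dim V$) for $V\le W$. $U^\perp$ denotes orthogonal complement w.r.t. the standard dot product. An $\mathbb{F}_q$-$[n\times m,k]$ code is a $k$-dimensional subspace $C\subseteq\mathbb{F}_q^{n\times m}$; $\operatorname{supp}(X)$ is the column space of $X$; $\operatorname{supp}(C)=\sum_{X\in C}\operatorname{supp}(X)$; $C$ is non-degenerate if $\operatorname{supp}(C)=\mathbb{F}_q^n$. $C_U=\{X\in C:\operatorname{supp}(X)\le U^\perp\}$, $\rho(U)=k-\dim C_U$, $\mathcal{M}[C]=(\mathcal{L}(E),\rho)$. Characteristic polynomial of an interval: $\mathbb{P}(\mathcal{M}([X,Y]);z)=\sum_{A\in[X,Y]}\mu(X,A)z^{\rho(Y)-\rho(A)}$; $\mathbb{P}(\mathcal{M};z)=\mathbb{P}(\mathcal{M}([0,E]);z)$; $\mathcal{M}.U=\mathcal{M}([U^\perp,E])$. A bilinear form $b:\mathbb{F}_q^n\times\mathbb{F}_q^m\to\mathbb{F}_q$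 is induced by $C$ if $b(x,y)=x^\top X y$ for some $X\in C$ (so its left kernel is $\operatorname{supp}(X)^\perp$); a tuple $(b_1,\dots,b_t)$ is induced by $C$ if each $b_i$ is. The tuple distinguishes $U\le\mathbb{F}_q^n$ if $\bigcap_{i=1}^t\operatorname{lker}(b_i)\le U^\perp$, where $\operatorname{lker}$ denotes the left kernel. -}

module Defs where

open import Level using (0ℓ)
open import Data.Bool using (Bool; true; false; if_then_else_; _∧_; not)
open import Data.Nat as ℕ using (ℕ; zero; suc; _∸_; _^_)
open import Data.Nat.Combinatorics using (_C_)
open import Data.Integer as ℤ using (ℤ; +_)
open import Data.List using (List; []; _∷_; map; concatMap; filterᵇ; length; foldr)
open import Data.Bool.ListAction using (all; any)
open import Data.List.Membership.Propositional using (_∈_)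
open import Data.List.Relation.Unary.Unique.Propositional using (Unique)
open import Data.Vec as V using (Vec; []; _∷_; zipWith)
open import Data.Vec.Properties using (≡-dec)
open import Data.Product using (∃; _×_)
open import Relation.Nullary using (¬_; does)
open import Relation.Binary.Definitions using (DecidableEquality)
open import Relation.Binary.PropositionalEquality using (_≡_)
open import Algebra.Structures using (IsCommutativeRing)

record FiniteField : Set₁ where
  field
    Carrier  : Set
    _+_ _*_  : Carrier → Carrier → Carrier
    -_       : Carrier → Carrier
    0# 1#    : Carrier
    isCommutativeRing : IsCommutativeRing _≡_ _+_ _*_ -_ 0# 1#
    0≢1      : ¬ (0# ≡ 1#)
    inverse  : ∀ x → ¬ (x ≡ 0#) → ∃ λ y → x * y ≡ 1#
    _≟_      : DecidableEquality Carrier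
    elements : List Carrier
    complete : ∀ x → x ∈ elements
    unique   : Unique elements

allVecsOf : {A : Set} → List A → (n : ℕ) → List (Vec A n)
allVecsOf xs zero    = [] ∷ []
allVecsOf xs (suc n) = concatMap (λ a → map (a ∷_) (allVecsOf xs n)) xs

-- all sublists (= all subsets, when the list has no duplicates)
sublists : {A : Set} → List A → List (List A)
sublists []       = [] ∷ []
sublists (x ∷ xs) = concatMap (λ s → (x ∷ s) ∷ s ∷ []) (sublists xs)

_^ℤ_ : ℤ → ℕ → ℤ
z ^ℤ zero  = + 1
z ^ℤ suc n = z ℤ.* (z ^ℤ n)

sumℤ : List ℤ → ℤ
sumℤ = foldr ℤ._+_ (+ 0)

module _ (F : FiniteField) where
  open FiniteField F

  card : ℕ
  card = length elements

  record FinSpace (A : Set) : Set where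
    field
      zeroV  : A
      addV   : A → A → A
      scaleV : Carrier → A → A
      eqV    : DecidableEquality A
      allV   : List A

  module _ {A : Set} (S : FinSpace A) where
    open FinSpace S

    memᵇ : A → List A → Bool
    memᵇ a xs = any (λ b → does (eqV a b)) xs

    subᵇ : List A → List A → Bool
    subᵇ U W = all (λ u → memᵇ u W) U

    subV : A → A → A
    subV u v = addV u (scaleV (- 1#) v)

    isSubspaceᵇ : List A → Bool
    isSubspaceᵇ L = memᵇ zeroV L
                  ∧ all (λ u → all (λ v → memᵇ (addV u v) L) L) L
                  ∧ all (λ a → all (λ v → memᵇ (scaleV a v) L) L) elements

    -- the lattice of subspaces: each subspace listed once, as a sublist of allV
    subspaces : List (List A)
    subspaces = filterᵇ isSubspaceᵇ (sublists allV)

    span : List A → List A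
    span []       = zeroV ∷ []
    span (b ∷ bs) = filterᵇ (λ v → any (λ a → memᵇ (subV v (scaleV a b)) (span bs)) elements) allV

    basisFrom : List A → List A → List A
    basisFrom acc []       = acc
    basisFrom acc (v ∷ vs) = if memᵇ v (span acc) then basisFrom acc vs else basisFrom (v ∷ acc) vs

    dim : List A → ℕ
    dim L = length (basisFrom [] L)

    record IsSubspace (L : List A) : Set where
      field
        nodup   : Unique L
        hasZero : zeroV ∈ L
        closed+ : ∀ {u v} → u ∈ L → v ∈ L → addV u v ∈ L
        closed· : ∀ a {v} → v ∈ L → scaleV a v ∈ L

  Vect : ℕ → Set
  Vect n = Vec Carrier n

  Mat : ℕ → ℕ → Set
  Mat n m = Vec (Vec Carrier m) n     -- n rows, m columns

  dot : ∀ {n} → Vect n → Vect n → Carrier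
  dot u v = V.foldr _ _+_ 0# (zipWith _*_ u v)

  allVecs : (n : ℕ) → List (Vect n)
  allVecs n = allVecsOf elements n

  FqN : (n : ℕ) → FinSpace (Vect n)
  FqN n = record
    { zeroV  = V.replicate n 0#
    ; addV   = zipWith _+_
    ; scaleV = λ a → V.map (a *_)
    ; eqV    = ≡-dec _≟_
    ; allV   = allVecs n }

  MatSp : (n m : ℕ) → FinSpace (Mat n m)
  MatSp n m = record
    { zeroV  = V.replicate n (V.replicate m 0#)
    ; addV   = zipWith (zipWith _+_)
    ; scaleV = λ a → V.map (V.map (a *_))
    ; eqV    = ≡-dec (≡-dec _≟_)
    ; allV   = allVecsOf (allVecs m) n }

  _·ᵥ_ : ∀ {n m} → Mat n m → Vect m → Vect n
  X ·ᵥ y = V.map (λ row → dot row y) X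

  perp : ∀ {n} → List (Vect n) → List (Vect n)
  perp {n} U = filterᵇ (λ v → all (λ u → does (dot u v ≟ 0#)) U) (allVecs n)

  -- support of a matrix: its column space (= image of y ↦ X y)
  supp : ∀ {n m} → Mat n m → List (Vect n)
  supp {n} {m} X = filterᵇ (λ v → any (λ y → does (≡-dec _≟_ (X ·ᵥ y) v)) (allVecs m)) (allVecs n)

  sumSub : ∀ {n} → List (List (Vect n)) → List (Vect n)
  sumSub {n} []       = FinSpace.zeroV (FqN n) ∷ []
  sumSub {n} (U ∷ Us) = filterᵇ (λ v → any (λ u → memᵇ (FqN n) (subV (FqN n) v u) (sumSub Us)) U) (allVecs n)

  record Code (n m : ℕ) : Set where
    field
      codewords  : List (Mat n m)
      isSubspace : IsSubspace (MatSp n m) codewords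
  open Code public

  module _ {n m : ℕ} (𝒞 : Code n m) where

    k : ℕ
    k = dim (MatSp n m) (codewords 𝒞)

    suppC : List (Vect n)
    suppC = sumSub (map supp (codewords 𝒞))

    NonDegenerate : Set
    NonDegenerate = ∀ (v : Vect n) → v ∈ suppC

    Crestr : List (Vect n) → List (Mat n m)
    Crestr U = filterᵇ (λ X → subᵇ (FqN n) (supp X) (perp U)) (codewords 𝒞)

    -- rank function of the q-polymatroid M[C]
    ρ : List (Vect n) → ℕ
    ρ U = k ∸ dim (MatSp n m) (Crestr U)

    -- Möbius function of L(E): μ(V,W) = (-1)^d q^(d choose 2), d = dim W - dim V
    μ : List (Vect n) → List (Vect n) → ℤ
    μ V W = ((ℤ.- + 1) ^ℤ d) ℤ.* (+ (card ^ (d C 2)))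
      where d = dim (FqN n) W ∸ dim (FqN n) V

    charPoly : List (Vect n) → List (Vect n) → ℤ → ℤ
    charPoly X Y z =
      sumℤ (map (λ A → μ X A ℤ.* (z ^ℤ (ρ Y ∸ ρ A)))
                (filterᵇ (λ A → subᵇ (FqN n) X A ∧ subᵇ (FqN n) A Y) (subspaces (FqN n))))

    E : List (Vect n)
    E = allVecs n

    zeroSpace : List (Vect n)
    zeroSpace = FinSpace.zeroV (FqN n) ∷ []

    charPolyM : ℤ → ℤ
    charPolyM = charPoly zeroSpace E

    -- P(M.U; z) = P(M([U^⊥,E]); z)
    charPolyContr : List (Vect n) → ℤ → ℤ
    charPolyContr U = charPoly (perp U) E

    -- Bilinear forms F_q^n × F_q^m → F_q are represented by their Gram matrix B
    -- (b(x,y) = xᵀ B y).  b is induced by C iff B ∈ C.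
    InducedByᵇ : Mat n m → Bool
    InducedByᵇ B = memᵇ (MatSp n m) B (codewords 𝒞)

    lker : Mat n m → List (Vect n)
    lker B = filterᵇ (λ x → all (λ y → does (dot x (B ·ᵥ y) ≟ 0#)) (allVecs m)) (allVecs n)

    lkerInter : ∀ {t} → Vec (Mat n m) t → List (Vect n)
    lkerInter bs = filterᵇ (λ x → V.foldr _ (λ B r → memᵇ (FqN n) x (lker B) ∧ r) true bs) (allVecs n)

    distinguishesᵇ : ∀ {t} → Vec (Mat n m) t → List (Vect n) → Bool
    distinguishesᵇ bs U = subᵇ (FqN n) (lkerInter bs) (perp U)

    countDistinguishing : (t : ℕ) → List (Vect n) → ℕ
    countDistinguishing t U =
      length (filterᵇ (λ bs → V.foldr _ (λ B r → InducedByᵇ B ∧ r) true bs ∧ distinguishesᵇ bs U)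
                      (allVecsOf (FinSpace.allV (MatSp n m)) t))

module Submission where

-- For A ≤ E one has ρ(E) - ρ(A) = dim C_A, so (q^t)^(ρ(E) - ρ(A)) = |C_A|^t is the number of t-tuples
-- from C whose left kernels all contain A. Expanding P(M.supp C; q^t) this way and exchanging the sums,
-- each tuple induced by C contributes Σ μ(X, A) over the interval X ≤ A ≤ K, where X = supp(C)^⊥ and
-- K = ⋂ lker(b_i) ≥ X. That sum is 1 if K = X, i.e. if the tuple distinguishes supp(C), and 0 otherwise.
-- For C non-degenerate, X = 0.

open import Level using (0ℓ)
open import Function using (_∘_; Equivalence)
open import Data.Empty using (⊥-elim)
open import Data.Product using (∃; _×_; _,_; proj₁; proj₂)
open import Data.Sum using (_⊎_; inj₁; inj₂)
open import Data.Bool using (Bool; true; false; if_then_else_; _∧_; _∨_; not)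
open import Data.Bool.Properties using (T-≡; not-injective; ∧-commutativeMonoid; ∧-conicalˡ; ∧-conicalʳ; ∧-zeroʳ)
open import Data.Bool.ListAction using (all; any)
open import Data.Nat as ℕ using (ℕ; zero; suc; _∸_; _^_)
import Data.Nat.Properties as ℕP
open import Data.Nat.Combinatorics using (nC1≡n; nCk+nC[k+1]≡[n+1]C[k+1]) renaming (_C_ to _choose_)
open import Data.Integer as ℤ using (ℤ; +_)
import Data.Integer.Properties as ℤP
open import Data.Integer.Tactic.RingSolver using (solve-∀)
open import Data.List using (List; []; _∷_; _++_; map; concatMap; filterᵇ; foldr; length)
open import Data.List.Properties using (length-filter)
open import Data.List.Membership.Propositional using (_∈_)
open import Data.List.Membership.Propositional.Properties using (∈-++⁺ˡ; ∈-++⁺ʳ; ∈-++⁻; ∈-filter⁺; ∈-filter⁻; ∈-map⁺; ∈-map⁻)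
open import Data.List.Relation.Unary.Any using (here; there)
open import Data.List.Relation.Unary.All using ([]; _∷_)
open import Data.List.Relation.Unary.All.Properties using (All¬⇒¬Any)
open import Data.List.Relation.Unary.AllPairs using ([]; _∷_)
import Data.List.Relation.Unary.AllPairs as AllPairs
open import Data.List.Relation.Unary.Unique.Propositional using (Unique)
import Data.List.Relation.Unary.Unique.Propositional.Properties as Unique
open import Data.Vec as Vec using (Vec; []; _∷_; zipWith)
open import Data.Vec.Properties using (∷-injective; ≡-dec; map-cong; map-const; map-id; map-∘; zipWith-assoc; zipWith-comm; zipWith-identityˡ)
open import Relation.Nullary using (¬_; does; yes; no)
open import Relation.Nullary.Decidable using (T?)
open import Relation.Binary.Definitions using (DecidableEquality)
open import Relation.Binary.PropositionalEquality
open import Algebra.Structures using (IsCommutativeSemiring)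
open import Algebra.Bundles using (CommutativeMonoid; CommutativeRing; CommutativeSemiring)
import Algebra.Properties.CommutativeSemigroup as CommutativeSemigroupProperties
import Algebra.Properties.Ring as RingProperties
open import Defs

filterᵇ-cons : ∀ {A : Set} (p : A → Bool) x xs →
  filterᵇ p (x ∷ xs) ≡ (if p x then x ∷ filterᵇ p xs else filterᵇ p xs)
filterᵇ-cons p x xs with p x
... | true  = refl
... | false = refl

∈-filterᵇ⁺ : ∀ {A : Set} (p : A → Bool) {x xs} → x ∈ xs → p x ≡ true → x ∈ filterᵇ p xs
∈-filterᵇ⁺ p x∈xs px = ∈-filter⁺ (T? ∘ p) x∈xs (Equivalence.from T-≡ px)

∈-filterᵇ⁻ : ∀ {A : Set} (p : A → Bool) {x xs} → x ∈ filterᵇ p xs → x ∈ xs × p x ≡ true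
∈-filterᵇ⁻ p {xs = xs} x∈ with ∈-filter⁻ (T? ∘ p) {xs = xs} x∈
... | x∈xs , px = x∈xs , Equivalence.to T-≡ px

filterᵇ-unique : ∀ {A : Set} (p : A → Bool) {xs} → Unique xs → Unique (filterᵇ p xs)
filterᵇ-unique p = Unique.filter⁺ (T? ∘ p)

filterᵇ-cong : ∀ {A : Set} (p p′ : A → Bool) xs →
  (∀ x → x ∈ xs → p x ≡ p′ x) → filterᵇ p xs ≡ filterᵇ p′ xs
filterᵇ-cong p p′ []       h = refl
filterᵇ-cong p p′ (x ∷ xs) h
  rewrite filterᵇ-cons p x xs | filterᵇ-cons p′ x xs | h x (here refl)
        | filterᵇ-cong p p′ xs (λ y y∈ → h y (there y∈)) = refl

unique-∉ : ∀ {A : Set} {x : A} {xs} → Unique (x ∷ xs) → ¬ x ∈ xs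
unique-∉ (x≢xs ∷ _) = All¬⇒¬Any x≢xs

does-≡ : ∀ {A : Set} (_≟_ : DecidableEquality A) {a b} → does (a ≟ b) ≡ true → a ≡ b
does-≡ _≟_ {a} {b} h with a ≟ b
... | yes a≡b = a≡b

≡-does : ∀ {A : Set} (_≟_ : DecidableEquality A) {a b} → a ≡ b → does (a ≟ b) ≡ true
≡-does _≟_ {a} {b} a≡b with a ≟ b
... | yes _  = refl
... | no a≢b = ⊥-elim (a≢b a≡b)

memBy : ∀ {A : Set} → DecidableEquality A → A → List A → Bool
memBy _≟_ a xs = any (λ b → does (a ≟ b)) xs

memBy⁺ : ∀ {A : Set} (_≟_ : DecidableEquality A) {a xs} → a ∈ xs → memBy _≟_ a xs ≡ true
memBy⁺ _≟_ {a} (here refl) rewrite ≡-does _≟_ {a} refl = refl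
memBy⁺ _≟_ {a} {y ∷ _} (there a∈) with does (a ≟ y)
... | true  = refl
... | false = memBy⁺ _≟_ a∈

memBy⁻ : ∀ {A : Set} (_≟_ : DecidableEquality A) {a xs} → memBy _≟_ a xs ≡ true → a ∈ xs
memBy⁻ _≟_ {a} {y ∷ _} h with a ≟ y
... | yes refl = here refl
... | no _     = there (memBy⁻ _≟_ h)

memBy-∉ : ∀ {A : Set} (_≟_ : DecidableEquality A) {a xs} → ¬ a ∈ xs → memBy _≟_ a xs ≡ false
memBy-∉ _≟_ {a} {xs} a∉ with memBy _≟_ a xs in e
... | true  = ⊥-elim (a∉ (memBy⁻ _≟_ e))
... | false = refl

open CommutativeSemigroupProperties (CommutativeMonoid.commutativeSemigroup ∧-commutativeMonoid)
  using () renaming (interchange to ∧-interchange)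

false≢true : ¬ false ≡ true
false≢true ()

≡-by-⇔ : ∀ {a b : Bool} → (a ≡ true → b ≡ true) → (b ≡ true → a ≡ true) → a ≡ b
≡-by-⇔ {true}  {true}  _ _ = refl
≡-by-⇔ {false} {false} _ _ = refl
≡-by-⇔ {true}  {false} f _ = sym (f refl)
≡-by-⇔ {false} {true}  _ g = g refl

any-intro : ∀ {A : Set} (p : A → Bool) {a} xs → a ∈ xs → p a ≡ true → any p xs ≡ true
any-intro p (x ∷ xs) (here refl) pa rewrite pa = refl
any-intro p (x ∷ xs) (there a∈) pa with p x
... | true  = refl
... | false = any-intro p xs a∈ pa

any-elim : ∀ {A : Set} (p : A → Bool) xs → any p xs ≡ true → ∃ λ a → a ∈ xs × p a ≡ true
any-elim p (x ∷ xs) h with p x in px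
... | true  = x , here refl , px
... | false with any-elim p xs h
...   | a , a∈ , pa = a , there a∈ , pa

all-intro : ∀ {A : Set} (p : A → Bool) xs → (∀ a → a ∈ xs → p a ≡ true) → all p xs ≡ true
all-intro p []       h = refl
all-intro p (x ∷ xs) h rewrite h x (here refl) = all-intro p xs (λ a a∈ → h a (there a∈))

all-elim : ∀ {A : Set} (p : A → Bool) xs → all p xs ≡ true → ∀ a → a ∈ xs → p a ≡ true
all-elim p (x ∷ xs) h a (here refl) = ∧-conicalˡ (p x) _ h
all-elim p (x ∷ xs) h a (there a∈) = all-elim p xs (∧-conicalʳ (p x) _ h) a a∈

all-false : ∀ {A : Set} (p : A → Bool) xs → all p xs ≡ false → ∃ λ a → a ∈ xs × p a ≡ false
all-false p (x ∷ xs) h with p x in px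
... | false = x , here refl , px
... | true with all-false p xs h
...   | a , a∈ , pa = a , there a∈ , pa

∈-concatMap⁺ : ∀ {A B : Set} (g : A → List B) {x a} ys → a ∈ ys → x ∈ g a → x ∈ concatMap g ys
∈-concatMap⁺ g (y ∷ ys) (here refl) x∈ = ∈-++⁺ˡ x∈
∈-concatMap⁺ g (y ∷ ys) (there a∈)  x∈ = ∈-++⁺ʳ (g y) (∈-concatMap⁺ g ys a∈ x∈)

∈-concatMap⁻ : ∀ {A B : Set} (g : A → List B) {x} ys → x ∈ concatMap g ys → ∃ λ a → a ∈ ys × x ∈ g a
∈-concatMap⁻ g (y ∷ ys) x∈ with ∈-++⁻ (g y) x∈
... | inj₁ x∈gy = y , here refl , x∈gy
... | inj₂ x∈rest with ∈-concatMap⁻ g ys x∈rest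
...   | a , a∈ , x∈ga = a , there a∈ , x∈ga

concatMap-unique : ∀ {A B : Set} (g : A → List B) ys → Unique ys → (∀ y → y ∈ ys → Unique (g y)) →
  (∀ y y′ z → y ∈ ys → y′ ∈ ys → z ∈ g y → z ∈ g y′ → y ≡ y′) → Unique (concatMap g ys)
concatMap-unique g [] _ _ _ = []
concatMap-unique g (y ∷ ys) uys ug shared =
  Unique.++⁺ (ug y (here refl))
             (concatMap-unique g ys (AllPairs.tail uys) (λ y′ y′∈ → ug y′ (there y′∈))
                               (λ a b z a∈ b∈ → shared a b z (there a∈) (there b∈)))
             disjoint
  where
  disjoint : ∀ {z} → ¬ (z ∈ g y × z ∈ concatMap g ys)
  disjoint (z∈gy , z∈rest) with ∈-concatMap⁻ g ys z∈rest
  ... | a , a∈ , z∈ga = unique-∉ uys (subst (_∈ ys) (sym (shared y a _ (here refl) (there a∈) z∈gy z∈ga)) a∈)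

allVecsOf-complete : ∀ {A : Set} (xs : List A) → (∀ x → x ∈ xs) → ∀ n (v : Vec A n) → v ∈ allVecsOf xs n
allVecsOf-complete xs all∈ zero    []      = here refl
allVecsOf-complete xs all∈ (suc n) (a ∷ v) =
  ∈-concatMap⁺ (λ a → map (a ∷_) (allVecsOf xs n)) xs (all∈ a) (∈-map⁺ (a ∷_) (allVecsOf-complete xs all∈ n v))

allVecsOf-unique : ∀ {A : Set} (xs : List A) → Unique xs → ∀ n → Unique (allVecsOf xs n)
allVecsOf-unique xs uxs zero    = [] ∷ []
allVecsOf-unique xs uxs (suc n) =
  concatMap-unique (λ a → map (a ∷_) (allVecsOf xs n)) xs uxs
    (λ a _ → Unique.map⁺ (proj₂ ∘ ∷-injective) (allVecsOf-unique xs uxs n)) sameHead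
  where
  sameHead : ∀ a b v → a ∈ xs → b ∈ xs → v ∈ map (a ∷_) (allVecsOf xs n) → v ∈ map (b ∷_) (allVecsOf xs n) → a ≡ b
  sameHead a b v _ _ v∈a v∈b with ∈-map⁻ (a ∷_) v∈a | ∈-map⁻ (b ∷_) v∈b
  ... | _ , _ , refl | _ , _ , e = proj₁ (∷-injective e)

∈-sublists-filterᵇ : ∀ {A : Set} (p : A → Bool) xs → filterᵇ p xs ∈ sublists xs
∈-sublists-filterᵇ p [] = here refl
∈-sublists-filterᵇ p (x ∷ xs) rewrite filterᵇ-cons p x xs with p x
... | true  = ∈-concatMap⁺ (λ s → (x ∷ s) ∷ s ∷ []) (sublists xs) (∈-sublists-filterᵇ p xs) (here refl)
... | false = ∈-concatMap⁺ (λ s → (x ∷ s) ∷ s ∷ []) (sublists xs) (∈-sublists-filterᵇ p xs) (there (here refl))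

sublist-⊆ : ∀ {A : Set} xs {s} → s ∈ sublists xs → ∀ {y : A} → y ∈ s → y ∈ xs
sublist-⊆ [] (here refl) ()
sublist-⊆ (x ∷ xs) s∈ y∈ with ∈-concatMap⁻ (λ s → (x ∷ s) ∷ s ∷ []) (sublists xs) s∈
sublist-⊆ (x ∷ xs) s∈ (here e)  | _ , _  , here refl = here e
sublist-⊆ (x ∷ xs) s∈ (there y∈) | _ , s′∈ , here refl = there (sublist-⊆ xs s′∈ y∈)
sublist-⊆ (x ∷ xs) s∈ y∈ | _ , s′∈ , there (here refl) = there (sublist-⊆ xs s′∈ y∈)

sublist-canonical : ∀ {A : Set} (_≟_ : DecidableEquality A) xs → Unique xs → ∀ {s} → s ∈ sublists xs →
  s ≡ filterᵇ (λ v → memBy _≟_ v s) xs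
sublist-canonical _≟_ [] _ (here refl) = refl
sublist-canonical _≟_ (x ∷ xs) uxs s∈ with ∈-concatMap⁻ (λ s → (x ∷ s) ∷ s ∷ []) (sublists xs) s∈
... | s′ , s′∈ , here refl
  rewrite filterᵇ-cons (λ v → memBy _≟_ v (x ∷ s′)) x xs | memBy⁺ _≟_ {x} {x ∷ s′} (here refl) =
  cong (x ∷_) (trans (sublist-canonical _≟_ xs (AllPairs.tail uxs) s′∈) (filterᵇ-cong _ _ xs notX))
  where
  notX : ∀ y → y ∈ xs → memBy _≟_ y s′ ≡ memBy _≟_ y (x ∷ s′)
  notX y y∈ with y ≟ x
  ... | yes refl = ⊥-elim (unique-∉ uxs y∈)
  ... | no _     = refl
... | s′ , s′∈ , there (here refl)
  rewrite filterᵇ-cons (λ v → memBy _≟_ v s′) x xs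
        | memBy-∉ _≟_ {x} {s′} (unique-∉ uxs ∘ sublist-⊆ xs s′∈) =
  sublist-canonical _≟_ xs (AllPairs.tail uxs) s′∈

sublists-unique : ∀ {A : Set} xs → Unique {A = A} xs → Unique (sublists xs)
sublists-unique [] _ = [] ∷ []
sublists-unique (x ∷ xs) uxs =
  concatMap-unique g (sublists xs) (sublists-unique xs (AllPairs.tail uxs)) (λ _ _ → (x∷s≢s ∷ []) ∷ [] ∷ []) shared
  where
  g : List _ → List (List _)
  g s = (x ∷ s) ∷ s ∷ []
  x∷s≢s : ∀ {s : List _} → ¬ (x ∷ s) ≡ s
  x∷s≢s e = ℕP.1+n≢n (cong length e)
  x∉ : ∀ {s} → s ∈ sublists xs → ¬ x ∈ s
  x∉ s∈ = unique-∉ uxs ∘ sublist-⊆ xs s∈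
  shared : ∀ s s′ z → s ∈ sublists xs → s′ ∈ sublists xs → z ∈ g s → z ∈ g s′ → s ≡ s′
  shared s s′ z _ _   (here refl)         (here refl)         = refl
  shared s s′ z _ s′∈ (here refl)         (there (here refl)) = ⊥-elim (x∉ s′∈ (here refl))
  shared s s′ z s∈ _  (there (here refl)) (here refl)         = ⊥-elim (x∉ s∈ (here refl))
  shared s s′ z _ _   (there (here refl)) (there (here refl)) = refl

memBy-filterᵇ : ∀ {A : Set} (_≟_ : DecidableEquality A) (p : A → Bool) x xs →
  memBy _≟_ x (filterᵇ p xs) ≡ (memBy _≟_ x xs ∧ p x)
memBy-filterᵇ _≟_ p x xs = ≡-by-⇔
  (λ h → let (x∈ , px) = ∈-filterᵇ⁻ p {x} {xs} (memBy⁻ _≟_ h) in cong₂ _∧_ (memBy⁺ _≟_ x∈) px)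
  (λ h → memBy⁺ _≟_ (∈-filterᵇ⁺ p (memBy⁻ _≟_ {x} {xs} (∧-conicalˡ _ _ h)) (∧-conicalʳ (memBy _≟_ x xs) _ h)))

unique-singleton : ∀ {A : Set} {z : A} xs → Unique xs → z ∈ xs → (∀ y → y ∈ xs → y ≡ z) → xs ≡ z ∷ []
unique-singleton (x ∷ [])     _   _ all≡z = cong (_∷ []) (all≡z x (here refl))
unique-singleton (x ∷ y ∷ xs) uxs _ all≡z =
  ⊥-elim (unique-∉ uxs (subst (_∈ y ∷ xs) (trans (all≡z y (there (here refl))) (sym (all≡z x (here refl)))) (here refl)))

-- Finite sums over lists

module Sums {C : Set} {_⊕_ _⊗_ : C → C → C} {𝟘 𝟙 : C}
            (isCommutativeSemiring : IsCommutativeSemiring _≡_ _⊕_ _⊗_ 𝟘 𝟙) where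
  open IsCommutativeSemiring isCommutativeSemiring
    using (+-assoc; +-identityˡ; +-identityʳ; distribˡ; distribʳ; zeroˡ; zeroʳ; *-identityˡ; *-identityʳ)

  commutativeSemiring : CommutativeSemiring 0ℓ 0ℓ
  commutativeSemiring = record { isCommutativeSemiring = isCommutativeSemiring }

  open CommutativeSemigroupProperties (CommutativeSemiring.+-commutativeSemigroup commutativeSemiring)
    using (interchange)

  Σ : ∀ {A : Set} → (A → C) → List A → C
  Σ f []       = 𝟘
  Σ f (x ∷ xs) = f x ⊕ Σ f xs

  ind : Bool → C → C
  ind b c = if b then c else 𝟘

  Σ-cong-∈ : ∀ {A : Set} {f g : A → C} xs → (∀ x → x ∈ xs → f x ≡ g x) → Σ f xs ≡ Σ g xs
  Σ-cong-∈ []       h = refl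
  Σ-cong-∈ (x ∷ xs) h = cong₂ _⊕_ (h x (here refl)) (Σ-cong-∈ xs (λ y y∈ → h y (there y∈)))

  Σ-cong : ∀ {A : Set} {f g : A → C} xs → (∀ x → f x ≡ g x) → Σ f xs ≡ Σ g xs
  Σ-cong xs h = Σ-cong-∈ xs (λ x _ → h x)

  Σ-𝟘 : ∀ {A : Set} (xs : List A) → Σ (λ _ → 𝟘) xs ≡ 𝟘
  Σ-𝟘 []       = refl
  Σ-𝟘 (x ∷ xs) = trans (+-identityˡ _) (Σ-𝟘 xs)

  Σ-vanish : ∀ {A : Set} {f : A → C} xs → (∀ x → x ∈ xs → f x ≡ 𝟘) → Σ f xs ≡ 𝟘
  Σ-vanish xs h = trans (Σ-cong-∈ xs h) (Σ-𝟘 xs)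

  Σ-⊕ : ∀ {A : Set} (f g : A → C) xs → Σ (λ x → f x ⊕ g x) xs ≡ Σ f xs ⊕ Σ g xs
  Σ-⊕ f g []       = sym (+-identityˡ 𝟘)
  Σ-⊕ f g (x ∷ xs) = trans (cong ((f x ⊕ g x) ⊕_) (Σ-⊕ f g xs)) (interchange _ _ _ _)

  Σ-⊗ˡ : ∀ {A : Set} (c : C) (f : A → C) xs → Σ (λ x → c ⊗ f x) xs ≡ c ⊗ Σ f xs
  Σ-⊗ˡ c f []       = sym (zeroʳ c)
  Σ-⊗ˡ c f (x ∷ xs) = trans (cong ((c ⊗ f x) ⊕_) (Σ-⊗ˡ c f xs)) (sym (distribˡ c _ _))

  Σ-swap : ∀ {A B : Set} (f : A → B → C) xs ys →
    Σ (λ x → Σ (f x) ys) xs ≡ Σ (λ y → Σ (λ x → f x y) xs) ys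
  Σ-swap f []       ys = sym (Σ-𝟘 ys)
  Σ-swap f (x ∷ xs) ys = trans (cong (Σ (f x) ys ⊕_) (Σ-swap f xs ys))
                               (sym (Σ-⊕ (f x) (λ y → Σ (λ x′ → f x′ y) xs) ys))

  Σ-++ : ∀ {A : Set} (f : A → C) xs ys → Σ f (xs ++ ys) ≡ Σ f xs ⊕ Σ f ys
  Σ-++ f []       ys = sym (+-identityˡ _)
  Σ-++ f (x ∷ xs) ys = trans (cong (f x ⊕_) (Σ-++ f xs ys)) (sym (+-assoc _ _ _))

  Σ-map : ∀ {A B : Set} (f : B → C) (g : A → B) xs → Σ f (map g xs) ≡ Σ (f ∘ g) xs
  Σ-map f g []       = refl
  Σ-map f g (x ∷ xs) = cong (f (g x) ⊕_) (Σ-map f g xs)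

  Σ-concatMap : ∀ {A B : Set} (f : B → C) (g : A → List B) xs →
    Σ f (concatMap g xs) ≡ Σ (λ x → Σ f (g x)) xs
  Σ-concatMap f g []       = refl
  Σ-concatMap f g (x ∷ xs) = trans (Σ-++ f (g x) (concatMap g xs)) (cong (Σ f (g x) ⊕_) (Σ-concatMap f g xs))

  Σ-filterᵇ : ∀ {A : Set} (f : A → C) (p : A → Bool) xs → Σ f (filterᵇ p xs) ≡ Σ (λ x → ind (p x) (f x)) xs
  Σ-filterᵇ f p [] = refl
  Σ-filterᵇ f p (x ∷ xs) rewrite filterᵇ-cons p x xs with p x
  ... | true  = cong (f x ⊕_) (Σ-filterᵇ f p xs)
  ... | false = trans (Σ-filterᵇ f p xs) (sym (+-identityˡ _))

  ind-∧ : ∀ a b c → ind (a ∧ b) c ≡ ind a (ind b c)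
  ind-∧ false b c = refl
  ind-∧ true  b c = refl

  ind-Σ : ∀ {A : Set} b (f : A → C) xs → ind b (Σ f xs) ≡ Σ (λ x → ind b (f x)) xs
  ind-Σ true  f xs = refl
  ind-Σ false f xs = sym (Σ-𝟘 xs)

  ind-⊗ : ∀ b c m → ind b (c ⊗ m) ≡ c ⊗ ind b m
  ind-⊗ true  c m = refl
  ind-⊗ false c m = sym (zeroʳ c)

  ⊗-ind𝟙 : ∀ c b → c ⊗ ind b 𝟙 ≡ ind b c
  ⊗-ind𝟙 c true  = *-identityʳ c
  ⊗-ind𝟙 c false = zeroʳ c

  Σ-ind-const : ∀ {A : Set} (p : A → Bool) c xs → Σ (λ a → ind (p a) c) xs ≡ Σ (λ a → ind (p a) 𝟙) xs ⊗ c
  Σ-ind-const p c []       = sym (zeroˡ c)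
  Σ-ind-const p c (x ∷ xs) = begin
    ind (p x) c ⊕ Σ (λ a → ind (p a) c) xs             ≡⟨ cong₂ _⊕_ (ind𝟙⊗ (p x)) (Σ-ind-const p c xs) ⟩
    (ind (p x) 𝟙 ⊗ c) ⊕ (Σ (λ a → ind (p a) 𝟙) xs ⊗ c) ≡⟨ sym (distribʳ c _ _) ⟩
    (ind (p x) 𝟙 ⊕ Σ (λ a → ind (p a) 𝟙) xs) ⊗ c       ∎
    where
    open ≡-Reasoning
    ind𝟙⊗ : ∀ b → ind b c ≡ ind b 𝟙 ⊗ c
    ind𝟙⊗ true  = sym (*-identityˡ c)
    ind𝟙⊗ false = sym (zeroˡ c)

  Σ-ind-singleton : ∀ {A : Set} (p : A → Bool) (f : A → C) {c : A} xs → Unique xs → c ∈ xs → p c ≡ true →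
    (∀ x → x ∈ xs → p x ≡ true → x ≡ c) → Σ (λ x → ind (p x) (f x)) xs ≡ f c
  Σ-ind-singleton p f (x ∷ xs) uxs (here refl) px only rewrite px =
    trans (cong (f x ⊕_) (Σ-vanish xs others)) (+-identityʳ _)
    where
    others : ∀ y → y ∈ xs → ind (p y) (f y) ≡ 𝟘
    others y y∈ with p y in py
    ... | true  = ⊥-elim (unique-∉ uxs (subst (_∈ xs) (only y (there y∈) py) y∈))
    ... | false = refl
  Σ-ind-singleton p f (x ∷ xs) uxs (there c∈) pc only with p x in px
  ... | true  = ⊥-elim (unique-∉ uxs (subst (_∈ xs) (sym (only x (here refl) px)) c∈))
  ... | false = trans (+-identityˡ _) (Σ-ind-singleton p f xs (AllPairs.tail uxs) c∈ pc (λ y y∈ → only y (there y∈)))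

  Σ-ind-none : ∀ {A : Set} (p : A → Bool) (f : A → C) xs → (∀ x → x ∈ xs → p x ≡ false) →
    Σ (λ x → ind (p x) (f x)) xs ≡ 𝟘
  Σ-ind-none p f xs none = Σ-vanish xs (λ x x∈ → cong (λ b → ind b (f x)) (none x x∈))

  module Universe {A : Set} (_≟_ : DecidableEquality A) (U : List A) (uniqueU : Unique U) (∈U : ∀ x → x ∈ U) where

    Σ-ind-≡ : (f : A → C) (c : A) → Σ (λ v → ind (does (v ≟ c)) (f v)) U ≡ f c
    Σ-ind-≡ f c = Σ-ind-singleton (λ v → does (v ≟ c)) f U uniqueU (∈U c) (≡-does _≟_ refl) (λ x _ → does-≡ _≟_)

    Σ-sublist : (f : A → C) (L : List A) → Unique L → Σ f L ≡ Σ (λ v → ind (memBy _≟_ v L) (f v)) U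
    Σ-sublist f []      _  = sym (Σ-𝟘 U)
    Σ-sublist f (x ∷ L) uL = begin
      f x ⊕ Σ f L
        ≡⟨ cong₂ _⊕_ (sym (Σ-ind-≡ f x)) (Σ-sublist f L (AllPairs.tail uL)) ⟩
      Σ (λ v → ind (does (v ≟ x)) (f v)) U ⊕ Σ (λ v → ind (memBy _≟_ v L) (f v)) U
        ≡⟨ sym (Σ-⊕ _ _ U) ⟩
      Σ (λ v → ind (does (v ≟ x)) (f v) ⊕ ind (memBy _≟_ v L) (f v)) U
        ≡⟨ Σ-cong U split ⟩
      Σ (λ v → ind (memBy _≟_ v (x ∷ L)) (f v)) U ∎
      where
      open ≡-Reasoning
      split : ∀ v → ind (does (v ≟ x)) (f v) ⊕ ind (memBy _≟_ v L) (f v) ≡ ind (memBy _≟_ v (x ∷ L)) (f v)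
      split v with v ≟ x
      ... | yes refl rewrite memBy-∉ _≟_ (unique-∉ uL) = +-identityʳ _
      ... | no _     = +-identityˡ _

module ℕΣ = Sums ℕP.+-*-isCommutativeSemiring
module ℤΣ = Sums ℤP.+-*-isCommutativeSemiring

length≡Σ1 : ∀ {A : Set} (xs : List A) → length xs ≡ ℕΣ.Σ (λ _ → 1) xs
length≡Σ1 []       = refl
length≡Σ1 (x ∷ xs) = cong suc (length≡Σ1 xs)

Σ-const : ∀ {A : Set} (c : ℕ) (xs : List A) → ℕΣ.Σ (λ _ → c) xs ≡ length xs ℕ.* c
Σ-const c []       = refl
Σ-const c (x ∷ xs) = cong (c ℕ.+_) (Σ-const c xs)

sumℤ≡Σ : ∀ {A : Set} (f : A → ℤ) xs → foldr ℤ._+_ (+ 0) (map f xs) ≡ ℤΣ.Σ f xs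
sumℤ≡Σ f []       = refl
sumℤ≡Σ f (x ∷ xs) = cong (ℤ._+_ (f x)) (sumℤ≡Σ f xs)

+-Σ : ∀ {A : Set} (f : A → ℕ) xs → + ℕΣ.Σ f xs ≡ ℤΣ.Σ (λ x → + f x) xs
+-Σ f []       = refl
+-Σ f (x ∷ xs) = trans (ℤP.pos-+ (f x) _) (cong (ℤ._+_ (+ f x)) (+-Σ f xs))

+-ind : ∀ b → + ℕΣ.ind b 1 ≡ ℤΣ.ind b (+ 1)
+-ind true  = refl
+-ind false = refl

ind-any≡Σ-ind : ∀ {A : Set} (p : A → Bool) xs → Unique xs →
  (∀ a b → a ∈ xs → b ∈ xs → p a ≡ true → p b ≡ true → a ≡ b) →
  ℕΣ.ind (any p xs) 1 ≡ ℕΣ.Σ (λ a → ℕΣ.ind (p a) 1) xs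
ind-any≡Σ-ind p [] _ _ = refl
ind-any≡Σ-ind p (x ∷ xs) uxs atMostOne with p x in px
... | true  = sym (cong suc (ℕΣ.Σ-ind-none p (λ _ → 1) xs others))
  where
  others : ∀ a → a ∈ xs → p a ≡ false
  others a a∈ with p a in pa
  ... | true  = ⊥-elim (unique-∉ uxs (subst (_∈ xs) (atMostOne a x (there a∈) (here refl) pa px) a∈))
  ... | false = refl
... | false = ind-any≡Σ-ind p xs (AllPairs.tail uxs) (λ a b a∈ b∈ → atMostOne a b (there a∈) (there b∈))

Σ-mono-≤ : ∀ {A : Set} {f g : A → ℕ} xs → (∀ x → f x ℕ.≤ g x) → ℕΣ.Σ f xs ℕ.≤ ℕΣ.Σ g xs
Σ-mono-≤ []       f≤g = ℕ.z≤n
Σ-mono-≤ (x ∷ xs) f≤g = ℕP.+-mono-≤ (f≤g x) (Σ-mono-≤ xs f≤g)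

term≤Σ : ∀ {A : Set} (f : A → ℕ) {x} xs → x ∈ xs → f x ℕ.≤ ℕΣ.Σ f xs
term≤Σ f (y ∷ xs) (here refl) = ℕP.m≤m+n (f y) _
term≤Σ f (y ∷ xs) (there x∈)  = ℕP.≤-trans (term≤Σ f xs x∈) (ℕP.m≤n+m _ (f y))

-- Finite vector spaces

module FieldProperties (F : FiniteField) where
  open FiniteField F using (isCommutativeRing)

  commutativeRing : CommutativeRing 0ℓ 0ℓ
  commutativeRing = record { isCommutativeRing = isCommutativeRing }

  open CommutativeRing commutativeRing public
    using (+-assoc; +-comm; +-identityˡ; +-identityʳ; *-assoc; *-comm; *-identityˡ;
           zeroˡ; zeroʳ; distribˡ; distribʳ; -‿inverseˡ; -‿inverseʳ)
  open RingProperties (CommutativeRing.ring commutativeRing) public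
    using (-1*x≈-x; -‿distribˡ-*; -‿distribʳ-*; -‿+-comm; -0#≈0#; -‿involutive; x∙y⁻¹≈ε⇒x≈y)
  open CommutativeSemigroupProperties (CommutativeRing.+-commutativeSemigroup commutativeRing) public
    using () renaming (interchange to +-interchange)

record VectorLaws (F : FiniteField) {B : Set} (addB : B → B → B) (scaleB : FiniteField.Carrier F → B → B) (zeroB : B) : Set where
  open FiniteField F
  field
    +-assoc     : ∀ u v w → addB (addB u v) w ≡ addB u (addB v w)
    +-comm      : ∀ u v → addB u v ≡ addB v u
    +-identityˡ : ∀ v → addB zeroB v ≡ v
    ·-identity  : ∀ v → scaleB 1# v ≡ v
    ·-assoc     : ∀ a b v → scaleB (a * b) v ≡ scaleB a (scaleB b v)
    ·-distribˡ  : ∀ a u v → scaleB a (addB u v) ≡ addB (scaleB a u) (scaleB a v)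
    ·-distribʳ  : ∀ a b v → scaleB (a + b) v ≡ addB (scaleB a v) (scaleB b v)
    ·-zeroˡ     : ∀ v → scaleB 0# v ≡ zeroB

record IsFinVectorSpace (F : FiniteField) {A : Set} (S : FinSpace F A) : Set where
  open FinSpace S
  field
    allV-unique   : Unique allV
    allV-complete : ∀ x → x ∈ allV
    vectorLaws    : VectorLaws F addV scaleV zeroV

module FinVectorSpace (F : FiniteField) {A : Set} (S : FinSpace F A) (isFVS : IsFinVectorSpace F S) where
  open FiniteField F using (_+_; _*_; -_; 0#; 1#; _≟_; inverse; elements; complete; unique)
  open FieldProperties F
  open FinSpace S
  open IsFinVectorSpace isFVS public using (allV-unique; allV-complete)
  open IsFinVectorSpace isFVS using (vectorLaws)
  open VectorLaws vectorLaws renaming (+-assoc to +ᵥ-assoc; +-comm to +ᵥ-comm; +-identityˡ to +ᵥ-identityˡ)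

  q : ℕ
  q = card F

  Pred : Set
  Pred = A → Bool

  transport : ∀ (P : Pred) {u v} → u ≡ v → P u ≡ true → P v ≡ true
  transport P u≡v = subst (λ x → P x ≡ true) u≡v

  count : Pred → ℕ
  count P = ℕΣ.Σ (λ v → ℕΣ.ind (P v) 1) allV

  mem : A → List A → Bool
  mem v xs = memᵇ F S v xs

  _⊆_ : Pred → Pred → Set
  P ⊆ Q = ∀ v → P v ≡ true → Q v ≡ true

  record IsSub (P : Pred) : Set where
    field
      zero∈    : P zeroV ≡ true
      +-closed : ∀ {u v} → P u ≡ true → P v ≡ true → P (addV u v) ≡ true
      ·-closed : ∀ a {v} → P v ≡ true → P (scaleV a v) ≡ true

  IsSub-cong : ∀ {P Q} → (∀ v → P v ≡ Q v) → IsSub P → IsSub Q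
  IsSub-cong {P} {Q} P≗Q sP = record
    { zero∈    = trans (sym (P≗Q zeroV)) zero∈
    ; +-closed = λ {u} {v} pu pv → trans (sym (P≗Q _)) (+-closed (trans (P≗Q u) pu) (trans (P≗Q v) pv))
    ; ·-closed = λ a {v} pv → trans (sym (P≗Q _)) (·-closed a (trans (P≗Q v) pv)) }
    where open IsSub sP

  mem-filterᵇ : (P : Pred) (v : A) → mem v (filterᵇ P allV) ≡ P v
  mem-filterᵇ P v with P v in pv
  ... | true  = memBy⁺ eqV (∈-filterᵇ⁺ P (allV-complete v) pv)
  ... | false = memBy-∉ eqV (λ v∈ → false≢true (trans (sym pv) (proj₂ (∈-filterᵇ⁻ P {xs = allV} v∈))))

  length-filterᵇ : (P : Pred) → length (filterᵇ P allV) ≡ count P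
  length-filterᵇ P = trans (length≡Σ1 (filterᵇ P allV)) (ℕΣ.Σ-filterᵇ (λ _ → 1) P allV)

  length≡count-mem : (L : List A) → Unique L → length L ≡ count (λ v → mem v L)
  length≡count-mem L uL = trans (length≡Σ1 L) (ℕΣ.Universe.Σ-sublist eqV allV allV-unique allV-complete (λ _ → 1) L uL)

  count-cong : ∀ P Q → (∀ v → P v ≡ Q v) → count P ≡ count Q
  count-cong P Q P≗Q = ℕΣ.Σ-cong allV (λ v → cong (λ b → ℕΣ.ind b 1) (P≗Q v))

  +ᵥ-identityʳ : ∀ v → addV v zeroV ≡ v
  +ᵥ-identityʳ v = trans (+ᵥ-comm v zeroV) (+ᵥ-identityˡ v)

  ·-zeroʳ : ∀ a → scaleV a zeroV ≡ zeroV
  ·-zeroʳ a = begin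
    scaleV a zeroV             ≡⟨ cong (scaleV a) (sym (·-zeroˡ zeroV)) ⟩
    scaleV a (scaleV 0# zeroV) ≡⟨ sym (·-assoc a 0# zeroV) ⟩
    scaleV (a * 0#) zeroV      ≡⟨ cong (λ b → scaleV b zeroV) (zeroʳ a) ⟩
    scaleV 0# zeroV            ≡⟨ ·-zeroˡ zeroV ⟩
    zeroV                      ∎
    where open ≡-Reasoning

  -1·-scaleV : ∀ a w → scaleV (- 1#) (scaleV a w) ≡ scaleV (- a) w
  -1·-scaleV a w = trans (sym (·-assoc (- 1#) a w)) (cong (λ b → scaleV b w) (-1*x≈-x a))

  subV-scaleV : ∀ u a w → subV F S u (scaleV a w) ≡ addV u (scaleV (- a) w)
  subV-scaleV u a w = cong (addV u) (-1·-scaleV a w)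

  subV-self : ∀ v → subV F S v v ≡ zeroV
  subV-self v = begin
    addV v (scaleV (- 1#) v)              ≡⟨ cong (λ x → addV x (scaleV (- 1#) v)) (sym (·-identity v)) ⟩
    addV (scaleV 1# v) (scaleV (- 1#) v)  ≡⟨ sym (·-distribʳ 1# (- 1#) v) ⟩
    scaleV (1# + (- 1#)) v                 ≡⟨ cong (λ b → scaleV b v) (-‿inverseʳ 1#) ⟩
    scaleV 0# v                           ≡⟨ ·-zeroˡ v ⟩
    zeroV                                 ∎
    where open ≡-Reasoning

  +ᵥ-interchange : ∀ a b c d → addV (addV a b) (addV c d) ≡ addV (addV a c) (addV b d)
  +ᵥ-interchange a b c d = begin
    addV (addV a b) (addV c d) ≡⟨ +ᵥ-assoc a b (addV c d) ⟩
    addV a (addV b (addV c d)) ≡⟨ cong (addV a) (sym (+ᵥ-assoc b c d)) ⟩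
    addV a (addV (addV b c) d) ≡⟨ cong (λ z → addV a (addV z d)) (+ᵥ-comm b c) ⟩
    addV a (addV (addV c b) d) ≡⟨ cong (addV a) (+ᵥ-assoc c b d) ⟩
    addV a (addV c (addV b d)) ≡⟨ sym (+ᵥ-assoc a c (addV b d)) ⟩
    addV (addV a c) (addV b d) ∎
    where open ≡-Reasoning

  addV-subV : ∀ u t → subV F S (addV u t) t ≡ u
  addV-subV u t = trans (+ᵥ-assoc u t _) (trans (cong (addV u) (subV-self t)) (+ᵥ-identityʳ u))

  subV-addV : ∀ u a w → addV (addV u (scaleV (- a) w)) (scaleV a w) ≡ u
  subV-addV u a w = begin
    addV (addV u (scaleV (- a) w)) (scaleV a w) ≡⟨ +ᵥ-assoc _ _ _ ⟩
    addV u (addV (scaleV (- a) w) (scaleV a w)) ≡⟨ cong (addV u) (sym (·-distribʳ (- a) a w)) ⟩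
    addV u (scaleV ((- a) + a) w)                 ≡⟨ cong (λ b → addV u (scaleV b w)) (-‿inverseˡ a) ⟩
    addV u (scaleV 0# w)                        ≡⟨ cong (addV u) (·-zeroˡ w) ⟩
    addV u zeroV                                ≡⟨ +ᵥ-identityʳ u ⟩
    u                                           ∎
    where open ≡-Reasoning

  subV-0· : ∀ u w → subV F S u (scaleV 0# w) ≡ u
  subV-0· u w = begin
    subV F S u (scaleV 0# w) ≡⟨ subV-scaleV u 0# w ⟩
    addV u (scaleV (- 0#) w) ≡⟨ cong (λ b → addV u (scaleV b w)) -0#≈0# ⟩
    addV u (scaleV 0# w)     ≡⟨ cong (addV u) (·-zeroˡ w) ⟩
    addV u zeroV             ≡⟨ +ᵥ-identityʳ u ⟩
    u                        ∎
    where open ≡-Reasoning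

  subV-difference : ∀ u a b w →
    subV F S (addV u (scaleV (- b) w)) (addV u (scaleV (- a) w)) ≡ scaleV ((- b) + a) w
  subV-difference u a b w = begin
    addV (addV u (scaleV (- b) w)) (scaleV (- 1#) (addV u (scaleV (- a) w)))
      ≡⟨ cong (addV (addV u (scaleV (- b) w))) (·-distribˡ (- 1#) u _) ⟩
    addV (addV u (scaleV (- b) w)) (addV (scaleV (- 1#) u) (scaleV (- 1#) (scaleV (- a) w)))
      ≡⟨ +ᵥ-interchange _ _ _ _ ⟩
    addV (subV F S u u) (addV (scaleV (- b) w) (scaleV (- 1#) (scaleV (- a) w)))
      ≡⟨ cong₂ addV (subV-self u) (cong (addV (scaleV (- b) w)) (trans (-1·-scaleV (- a) w) (cong (λ c → scaleV c w) (-‿involutive a)))) ⟩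
    addV zeroV (addV (scaleV (- b) w) (scaleV a w))
      ≡⟨ +ᵥ-identityˡ _ ⟩
    addV (scaleV (- b) w) (scaleV a w)
      ≡⟨ sym (·-distribʳ _ _ w) ⟩
    scaleV ((- b) + a) w ∎
    where open ≡-Reasoning

  _+⟨_⟩ : Pred → A → Pred
  (P +⟨ w ⟩) u = any (λ a → P (subV F S u (scaleV a w))) elements

  +⟨⟩-intro : ∀ P w u a → P (subV F S u (scaleV a w)) ≡ true → (P +⟨ w ⟩) u ≡ true
  +⟨⟩-intro P w u a = any-intro (λ a → P (subV F S u (scaleV a w))) elements (complete a)

  +⟨⟩-isSub : ∀ {P} → IsSub P → ∀ w → IsSub (P +⟨ w ⟩)
  +⟨⟩-isSub {P} sP w = record { zero∈ = zero∈′ ; +-closed = +-closed′ ; ·-closed = ·-closed′ }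
    where
    open IsSub sP
    zero∈′ : (P +⟨ w ⟩) zeroV ≡ true
    zero∈′ = +⟨⟩-intro P w zeroV 0# (transport P (sym (subV-0· zeroV w)) zero∈)
    +-closed′ : ∀ {u v} → (P +⟨ w ⟩) u ≡ true → (P +⟨ w ⟩) v ≡ true → (P +⟨ w ⟩) (addV u v) ≡ true
    +-closed′ {u} {v} hu hv with any-elim _ elements hu | any-elim _ elements hv
    ... | a , _ , pa | b , _ , pb = +⟨⟩-intro P w (addV u v) (a + b)
          (transport P (sym split) (+-closed (transport P (subV-scaleV u a w) pa) (transport P (subV-scaleV v b w) pb)))
      where
      split : subV F S (addV u v) (scaleV (a + b) w) ≡ addV (addV u (scaleV (- a) w)) (addV v (scaleV (- b) w))
      split = begin
        subV F S (addV u v) (scaleV (a + b) w)                      ≡⟨ subV-scaleV _ _ _ ⟩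
        addV (addV u v) (scaleV (- (a + b)) w)                      ≡⟨ cong (λ c → addV (addV u v) (scaleV c w)) (sym (-‿+-comm a b)) ⟩
        addV (addV u v) (scaleV ((- a) + (- b)) w)                  ≡⟨ cong (addV (addV u v)) (·-distribʳ _ _ w) ⟩
        addV (addV u v) (addV (scaleV (- a) w) (scaleV (- b) w))    ≡⟨ +ᵥ-interchange _ _ _ _ ⟩
        addV (addV u (scaleV (- a) w)) (addV v (scaleV (- b) w))    ∎
        where open ≡-Reasoning
    ·-closed′ : ∀ c {v} → (P +⟨ w ⟩) v ≡ true → (P +⟨ w ⟩) (scaleV c v) ≡ true
    ·-closed′ c {v} hv with any-elim _ elements hv
    ... | a , _ , pa = +⟨⟩-intro P w (scaleV c v) (c * a)
          (transport P (sym split) (·-closed c (transport P (subV-scaleV v a w) pa)))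
      where
      split : subV F S (scaleV c v) (scaleV (c * a) w) ≡ scaleV c (addV v (scaleV (- a) w))
      split = begin
        subV F S (scaleV c v) (scaleV (c * a) w)        ≡⟨ subV-scaleV _ _ _ ⟩
        addV (scaleV c v) (scaleV (- (c * a)) w)        ≡⟨ cong (λ b → addV (scaleV c v) (scaleV b w)) (-‿distribʳ-* c a) ⟩
        addV (scaleV c v) (scaleV (c * (- a)) w)        ≡⟨ cong (addV (scaleV c v)) (·-assoc c (- a) w) ⟩
        addV (scaleV c v) (scaleV c (scaleV (- a) w))   ≡⟨ sym (·-distribˡ c v _) ⟩
        scaleV c (addV v (scaleV (- a) w))              ∎
        where open ≡-Reasoning

  +⟨⟩-⊇ : ∀ P w → P ⊆ (P +⟨ w ⟩)
  +⟨⟩-⊇ P w u pu = +⟨⟩-intro P w u 0# (transport P (sym (subV-0· u w)) pu)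

  +⟨⟩-∋ : ∀ {P} → IsSub P → ∀ w → (P +⟨ w ⟩) w ≡ true
  +⟨⟩-∋ {P} sP w = +⟨⟩-intro P w w 1#
    (transport P (sym (trans (cong (subV F S w) (·-identity w)) (subV-self w))) (IsSub.zero∈ sP))

  +⟨⟩-least : ∀ {P L} → IsSub L → P ⊆ L → ∀ {w} → L w ≡ true → (P +⟨ w ⟩) ⊆ L
  +⟨⟩-least {P} {L} sL P⊆L {w} lw u h with any-elim _ elements h
  ... | a , _ , pa = transport L (subV-addV u a w)
          (IsSub.+-closed sL (transport L (subV-scaleV u a w) (P⊆L _ pa)) (IsSub.·-closed sL a lw))

  +⟨⟩-mono : ∀ {P Q} → P ⊆ Q → ∀ w → (P +⟨ w ⟩) ⊆ (Q +⟨ w ⟩)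
  +⟨⟩-mono {P} {Q} P⊆Q w u h with any-elim _ elements h
  ... | a , _ , pa = +⟨⟩-intro Q w u a (P⊆Q _ pa)

  Σ-translate : ∀ (t : A) (f : A → ℕ) → ℕΣ.Σ (λ u → f (addV u t)) allV ≡ ℕΣ.Σ f allV
  Σ-translate t f = begin
    ℕΣ.Σ (λ u → f (addV u t)) allV                  ≡⟨ sym (ℕΣ.Σ-map f (λ u → addV u t) allV) ⟩
    ℕΣ.Σ f shifted                                  ≡⟨ ℕΣ.Universe.Σ-sublist eqV allV allV-unique allV-complete f shifted shifted-unique ⟩
    ℕΣ.Σ (λ v → ℕΣ.ind (mem v shifted) (f v)) allV  ≡⟨ ℕΣ.Σ-cong allV (λ v → cong (λ b → ℕΣ.ind b (f v)) (∈-shifted v)) ⟩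
    ℕΣ.Σ f allV                                     ∎
    where
    open ≡-Reasoning
    shifted = map (λ u → addV u t) allV
    shifted-unique : Unique shifted
    shifted-unique = Unique.map⁺ (λ {x} {y} e → trans (sym (addV-subV x t)) (trans (cong (λ z → subV F S z t) e) (addV-subV y t))) allV-unique
    ∈-shifted : ∀ v → mem v shifted ≡ true
    ∈-shifted v = memBy⁺ eqV (subst (_∈ shifted) back (∈-map⁺ (λ u → addV u t) (allV-complete (subV F S v t))))
      where
      back : addV (subV F S v t) t ≡ v
      back = trans (+ᵥ-assoc _ _ _) (trans (cong (addV v) (+ᵥ-comm _ t)) (trans (cong (addV v) (subV-self t)) (+ᵥ-identityʳ v)))

  -- Two coefficients a ≠ b would put (a - b) w, hence w, into P.
  +⟨⟩-coefficient-unique : ∀ {P} → IsSub P → ∀ {w} → P w ≡ false → ∀ u a b →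
    P (subV F S u (scaleV a w)) ≡ true → P (subV F S u (scaleV b w)) ≡ true → a ≡ b
  +⟨⟩-coefficient-unique {P} sP {w} pw u a b pa pb with a ≟ b
  ... | yes a≡b = a≡b
  ... | no a≢b with inverse ((- b) + a) (λ e → a≢b (x∙y⁻¹≈ε⇒x≈y a b (trans (+-comm a (- b)) e)))
  ...   | i , di = ⊥-elim (false≢true (trans (sym pw) (transport P rescale (IsSub.·-closed sP i diff∈P))))
    where
    diff∈P : P (scaleV ((- b) + a) w) ≡ true
    diff∈P = transport P (subV-difference u a b w)
               (IsSub.+-closed sP (transport P (subV-scaleV u b w) pb)
                                  (IsSub.·-closed sP (- 1#) (transport P (subV-scaleV u a w) pa)))
    rescale : scaleV i (scaleV ((- b) + a) w) ≡ w
    rescale = trans (sym (·-assoc i _ w)) (trans (cong (λ c → scaleV c w) (trans (*-comm i _) di)) (·-identity w))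

  count-+⟨⟩ : ∀ {P} → IsSub P → ∀ {w} → P w ≡ false → count (P +⟨ w ⟩) ≡ q ℕ.* count P
  count-+⟨⟩ {P} sP {w} pw = begin
    count (P +⟨ w ⟩)
      ≡⟨ ℕΣ.Σ-cong allV (λ u → ind-any≡Σ-ind _ elements unique (λ a b _ _ → +⟨⟩-coefficient-unique sP pw u a b)) ⟩
    ℕΣ.Σ (λ u → ℕΣ.Σ (λ a → ℕΣ.ind (P (subV F S u (scaleV a w))) 1) elements) allV
      ≡⟨ ℕΣ.Σ-swap (λ u a → ℕΣ.ind (P (subV F S u (scaleV a w))) 1) allV elements ⟩
    ℕΣ.Σ (λ a → ℕΣ.Σ (λ u → ℕΣ.ind (P (subV F S u (scaleV a w))) 1) allV) elements
      ≡⟨ ℕΣ.Σ-cong elements (λ a → Σ-translate (scaleV (- 1#) (scaleV a w)) (λ v → ℕΣ.ind (P v) 1)) ⟩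
    ℕΣ.Σ (λ _ → count P) elements
      ≡⟨ Σ-const (count P) elements ⟩
    q ℕ.* count P ∎
    where open ≡-Reasoning

  ⟦span_⟧ : List A → Pred
  ⟦span bs ⟧ v = mem v (span F S bs)

  span-∷ : ∀ b bs v → ⟦span b ∷ bs ⟧ v ≡ (⟦span bs ⟧ +⟨ b ⟩) v
  span-∷ b bs = mem-filterᵇ (⟦span bs ⟧ +⟨ b ⟩)

  span-[]-elim : ∀ v → ⟦span [] ⟧ v ≡ true → v ≡ zeroV
  span-[]-elim v h with eqV v zeroV
  ... | yes v≡0 = v≡0

  span-[]-intro : ⟦span [] ⟧ zeroV ≡ true
  span-[]-intro = memBy⁺ eqV {xs = zeroV ∷ []} (here refl)

  span-isSub : ∀ bs → IsSub ⟦span bs ⟧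
  span-isSub [] = record
    { zero∈    = span-[]-intro
    ; +-closed = λ {u} {v} pu pv → transport ⟦span [] ⟧
                   (sym (trans (cong₂ addV (span-[]-elim u pu) (span-[]-elim v pv)) (+ᵥ-identityˡ zeroV))) span-[]-intro
    ; ·-closed = λ a {v} pv → transport ⟦span [] ⟧
                   (sym (trans (cong (scaleV a) (span-[]-elim v pv)) (·-zeroʳ a))) span-[]-intro }
  span-isSub (b ∷ bs) = IsSub-cong (λ v → sym (span-∷ b bs v)) (+⟨⟩-isSub (span-isSub bs) b)

  count-span-[] : count ⟦span [] ⟧ ≡ 1
  count-span-[] = trans (ℕΣ.Σ-cong allV (λ v → cong (λ c → ℕΣ.ind c 1) (∨-false (does (eqV v zeroV)))))
                        (ℕΣ.Universe.Σ-ind-≡ eqV allV allV-unique allV-complete (λ _ → 1) zeroV)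
    where
    ∨-false : ∀ b → (b ∨ false) ≡ b
    ∨-false true  = refl
    ∨-false false = refl

  span-least : ∀ {L} → IsSub L → ∀ bs → (∀ x → x ∈ bs → L x ≡ true) → ⟦span bs ⟧ ⊆ L
  span-least sL [] _ v pv = transport _ (sym (span-[]-elim v pv)) (IsSub.zero∈ sL)
  span-least sL (b ∷ bs) bs⊆L v pv =
    +⟨⟩-least sL (span-least sL bs (λ x x∈ → bs⊆L x (there x∈))) (bs⊆L b (here refl)) v
      (trans (sym (span-∷ b bs v)) pv)

  span-∷-⊇ : ∀ b bs → ⟦span bs ⟧ ⊆ ⟦span b ∷ bs ⟧
  span-∷-⊇ b bs v h = trans (span-∷ b bs v) (+⟨⟩-⊇ ⟦span bs ⟧ b v h)

  span-∷-∋ : ∀ b bs → ⟦span b ∷ bs ⟧ b ≡ true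
  span-∷-∋ b bs = trans (span-∷ b bs b) (+⟨⟩-∋ (span-isSub bs) b)

  count-span-∷ : ∀ b bs → ⟦span bs ⟧ b ≡ false → count ⟦span b ∷ bs ⟧ ≡ q ℕ.* count ⟦span bs ⟧
  count-span-∷ b bs b∉ = trans (count-cong _ _ (span-∷ b bs)) (count-+⟨⟩ (span-isSub bs) b∉)

  span-acc⊆span-basisFrom : ∀ acc vs → ⟦span acc ⟧ ⊆ ⟦span basisFrom F S acc vs ⟧
  span-acc⊆span-basisFrom acc []       v h = h
  span-acc⊆span-basisFrom acc (x ∷ vs) v h with mem x (span F S acc)
  ... | true  = span-acc⊆span-basisFrom acc vs v h
  ... | false = span-acc⊆span-basisFrom (x ∷ acc) vs v (span-∷-⊇ x acc v h)

  ∈-span-basisFrom : ∀ acc vs v → v ∈ vs → ⟦span basisFrom F S acc vs ⟧ v ≡ true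
  ∈-span-basisFrom acc (x ∷ vs) v v∈ with mem x (span F S acc) in x∈span
  ∈-span-basisFrom acc (x ∷ vs) v (here refl) | true  = span-acc⊆span-basisFrom acc vs v x∈span
  ∈-span-basisFrom acc (x ∷ vs) v (there v∈) | true  = ∈-span-basisFrom acc vs v v∈
  ∈-span-basisFrom acc (x ∷ vs) v (here refl) | false = span-acc⊆span-basisFrom (x ∷ acc) vs v (span-∷-∋ x acc)
  ∈-span-basisFrom acc (x ∷ vs) v (there v∈) | false = ∈-span-basisFrom (x ∷ acc) vs v v∈

  -- Each vector kept by basisFrom is outside the span so far, so it multiplies the count by q.
  count-span-basisFrom : ∀ acc vs → count ⟦span acc ⟧ ≡ q ℕ.^ length acc →
    count ⟦span basisFrom F S acc vs ⟧ ≡ q ℕ.^ length (basisFrom F S acc vs)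
  count-span-basisFrom acc []       h = h
  count-span-basisFrom acc (x ∷ vs) h with mem x (span F S acc) in x∈span
  ... | true  = count-span-basisFrom acc vs h
  ... | false = count-span-basisFrom (x ∷ acc) vs (trans (count-span-∷ x acc x∈span) (cong (q ℕ.*_) h))

  basisFrom-⊆ : ∀ (L : Pred) acc vs → (∀ x → x ∈ acc → L x ≡ true) → (∀ x → x ∈ vs → L x ≡ true) →
    ∀ x → x ∈ basisFrom F S acc vs → L x ≡ true
  basisFrom-⊆ L acc []       acc⊆L vs⊆L = acc⊆L
  basisFrom-⊆ L acc (y ∷ vs) acc⊆L vs⊆L with mem y (span F S acc)
  ... | true  = basisFrom-⊆ L acc vs acc⊆L (λ x x∈ → vs⊆L x (there x∈))
  ... | false = basisFrom-⊆ L (y ∷ acc) vs y∷acc⊆L (λ x x∈ → vs⊆L x (there x∈))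
    where
    y∷acc⊆L : ∀ x → x ∈ y ∷ acc → L x ≡ true
    y∷acc⊆L x (here refl) = vs⊆L y (here refl)
    y∷acc⊆L x (there x∈)  = acc⊆L x x∈

  IsSubspace⇒IsSub : ∀ L → IsSubspace F S L → IsSub (λ v → mem v L)
  IsSubspace⇒IsSub L sL = record
    { zero∈    = memBy⁺ eqV (IsSubspace.hasZero sL)
    ; +-closed = λ pu pv → memBy⁺ eqV (IsSubspace.closed+ sL (memBy⁻ eqV pu) (memBy⁻ eqV pv))
    ; ·-closed = λ a pv → memBy⁺ eqV (IsSubspace.closed· sL a (memBy⁻ eqV pv)) }

  -- A subspace is the span of the basis extracted from it.
  length≡q^dim : ∀ L → IsSubspace F S L → length L ≡ q ℕ.^ dim F S L
  length≡q^dim L sL = begin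
    length L                           ≡⟨ length≡count-mem L (IsSubspace.nodup sL) ⟩
    count (λ v → mem v L)              ≡⟨ count-cong _ _ L≗span ⟩
    count ⟦span basis ⟧                ≡⟨ count-span-basisFrom [] L count-span-[] ⟩
    q ℕ.^ length basis                 ∎
    where
    open ≡-Reasoning
    basis = basisFrom F S [] L
    L≗span : ∀ v → mem v L ≡ ⟦span basis ⟧ v
    L≗span v = ≡-by-⇔ (λ v∈L → ∈-span-basisFrom [] L v (memBy⁻ eqV v∈L))
                      (span-least (IsSubspace⇒IsSub L sL) basis (basisFrom-⊆ _ [] L (λ _ ()) (λ _ → memBy⁺ eqV)) v)

  filterᵇ-IsSubspace : ∀ {P} → IsSub P → IsSubspace F S (filterᵇ P allV)
  filterᵇ-IsSubspace {P} sP = record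
    { nodup   = filterᵇ-unique P allV-unique
    ; hasZero = ∈-filterᵇ⁺ P (allV-complete zeroV) zero∈
    ; closed+ = λ u∈ v∈ → ∈-filterᵇ⁺ P (allV-complete _) (+-closed (holds u∈) (holds v∈))
    ; closed· = λ a v∈ → ∈-filterᵇ⁺ P (allV-complete _) (·-closed a (holds v∈)) }
    where
    open IsSub sP
    holds : ∀ {v} → v ∈ filterᵇ P allV → P v ≡ true
    holds v∈ = proj₂ (∈-filterᵇ⁻ P {xs = allV} v∈)

  count≡q^dim : ∀ {P} → IsSub P → count P ≡ q ℕ.^ dim F S (filterᵇ P allV)
  count≡q^dim {P} sP = trans (sym (length-filterᵇ P)) (length≡q^dim _ (filterᵇ-IsSubspace sP))

  ≗-by-⊆ : ∀ {P Q} → P ⊆ Q → Q ⊆ P → ∀ v → P v ≡ Q v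
  ≗-by-⊆ P⊆Q Q⊆P v = ≡-by-⇔ (P⊆Q v) (Q⊆P v)

  count-mono : ∀ {P Q} → P ⊆ Q → count P ℕ.≤ count Q
  count-mono {P} {Q} P⊆Q = Σ-mono-≤ allV pointwise
    where
    pointwise : ∀ v → ℕΣ.ind (P v) 1 ℕ.≤ ℕΣ.ind (Q v) 1
    pointwise v with P v in pv
    ... | true rewrite P⊆Q v pv = ℕP.≤-refl
    ... | false = ℕ.z≤n

  count-split : ∀ (P H : Pred) → count P ≡ count (λ v → P v ∧ H v) ℕ.+ count (λ v → P v ∧ not (H v))
  count-split P H = trans (ℕΣ.Σ-cong allV pointwise) (ℕΣ.Σ-⊕ _ _ allV)
    where
    pointwise : ∀ v → ℕΣ.ind (P v) 1 ≡ ℕΣ.ind (P v ∧ H v) 1 ℕ.+ ℕΣ.ind (P v ∧ not (H v)) 1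
    pointwise v with P v | H v
    ... | true  | true  = refl
    ... | true  | false = refl
    ... | false | _     = refl

  count-⊂ : ∀ {P Q} → P ⊆ Q → ∀ {v} → Q v ≡ true → P v ≡ false → count P ℕ.< count Q
  count-⊂ {P} {Q} P⊆Q {v} qv pv = begin-strict
    count P                                               <⟨ ℕP.m<m+n (count P) rest-nonempty ⟩
    count P ℕ.+ count (λ u → Q u ∧ not (P u))             ≡⟨ cong (ℕ._+ count (λ u → Q u ∧ not (P u))) (count-cong _ _ Q∧P≗P) ⟨
    count (λ u → Q u ∧ P u) ℕ.+ count (λ u → Q u ∧ not (P u)) ≡⟨ count-split Q P ⟨
    count Q                                               ∎
    where
    open ℕP.≤-Reasoning
    Q∧P≗P : ∀ u → (Q u ∧ P u) ≡ P u
    Q∧P≗P u with P u in pu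
    ... | true rewrite P⊆Q u pu = refl
    ... | false = ∧-zeroʳ (Q u)
    rest-nonempty : 0 ℕ.< count (λ u → Q u ∧ not (P u))
    rest-nonempty = ℕP.≤-trans (ℕP.≤-reflexive (cong (λ b → ℕΣ.ind b 1) (sym (cong₂ _∧_ qv (cong not pv)))))
                               (term≤Σ (λ u → ℕΣ.ind (Q u ∧ not (P u)) 1) allV (allV-complete v))

  count-≤⇒⊇ : ∀ {P Q} → P ⊆ Q → count Q ℕ.≤ count P → Q ⊆ P
  count-≤⇒⊇ {P} {Q} P⊆Q Q≤P v qv with P v in pv
  ... | true  = refl
  ... | false = ⊥-elim (ℕP.<⇒≱ (count-⊂ P⊆Q qv pv) Q≤P)

  count-pos : ∀ {P} → IsSub P → 1 ℕ.≤ count P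
  count-pos {P} sP = ℕP.≤-trans (ℕP.≤-reflexive (cong (λ b → ℕΣ.ind b 1) (sym (IsSub.zero∈ sP))))
                                (term≤Σ (λ v → ℕΣ.ind (P v) 1) allV (allV-complete zeroV))

  2≤q : 2 ℕ.≤ q
  2≤q = two-elements elements unique (complete 0#) (complete 1#) 0≢1
    where
    open FiniteField F using (0≢1)
    two-elements : ∀ {B : Set} {a b : B} xs → Unique xs → a ∈ xs → b ∈ xs → ¬ a ≡ b → 2 ℕ.≤ length xs
    two-elements (x ∷ [])     _ (here refl) (here refl) a≢b = ⊥-elim (a≢b refl)
    two-elements (x ∷ y ∷ xs) _ _ _ _ = ℕ.s≤s (ℕ.s≤s ℕ.z≤n)

  q^-reflect-≤ : ∀ {a b} → q ℕ.^ a ℕ.≤ q ℕ.^ b → a ℕ.≤ b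
  q^-reflect-≤ {a} {b} q^a≤q^b with ℕP.≤-<-connex a b
  ... | inj₁ a≤b = a≤b
  ... | inj₂ b<a = ⊥-elim (ℕP.<⇒≱ (ℕP.^-monoʳ-< q 2≤q b<a) q^a≤q^b)

  q^-injective : ∀ {a b} → q ℕ.^ a ≡ q ℕ.^ b → a ≡ b
  q^-injective e = ℕP.≤-antisym (q^-reflect-≤ (ℕP.≤-reflexive e)) (q^-reflect-≤ (ℕP.≤-reflexive (sym e)))

  q^-pos : ∀ k → 1 ℕ.≤ q ℕ.^ k
  q^-pos k = ℕP.m^n>0 q ⦃ ℕ.>-nonZero (ℕP.≤-trans (ℕ.s≤s ℕ.z≤n) 2≤q) ⦄ k

  +⟨⟩-exchange : ∀ {H} → IsSub H → ∀ {v u} → H v ≡ false → (H +⟨ u ⟩) v ≡ true → (H +⟨ v ⟩) u ≡ true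
  +⟨⟩-exchange {H} sH {v} {u} hv v∈H+u with any-elim _ elements v∈H+u
  ... | c , _ , hc with c ≟ 0#
  ...   | yes refl = ⊥-elim (false≢true (trans (sym hv) (transport H (subV-0· v u) hc)))
  ...   | no c≢0 with inverse c c≢0
  ...     | i , ci = +⟨⟩-intro H v u i (transport H solve (IsSub.·-closed sH (- i) (transport H (subV-scaleV v c u) hc)))
    where
    open ≡-Reasoning
    -i·-c≡1 : ((- i) * (- c)) ≡ 1#
    -i·-c≡1 = begin
      (- i) * (- c)   ≡⟨ -‿distribˡ-* i (- c) ⟨
      - (i * (- c))   ≡⟨ cong -_ (-‿distribʳ-* i c) ⟨
      - (- (i * c))   ≡⟨ -‿involutive (i * c) ⟩
      i * c           ≡⟨ *-comm i c ⟩
      c * i           ≡⟨ ci ⟩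
      1#              ∎
    solve : scaleV (- i) (addV v (scaleV (- c) u)) ≡ subV F S u (scaleV i v)
    solve = begin
      scaleV (- i) (addV v (scaleV (- c) u))                 ≡⟨ ·-distribˡ (- i) v _ ⟩
      addV (scaleV (- i) v) (scaleV (- i) (scaleV (- c) u))  ≡⟨ cong (addV (scaleV (- i) v)) (sym (·-assoc (- i) (- c) u)) ⟩
      addV (scaleV (- i) v) (scaleV ((- i) * (- c)) u)       ≡⟨ cong (λ a → addV (scaleV (- i) v) (scaleV a u)) -i·-c≡1 ⟩
      addV (scaleV (- i) v) (scaleV 1# u)                    ≡⟨ cong (addV (scaleV (- i) v)) (·-identity u) ⟩
      addV (scaleV (- i) v) u                                ≡⟨ +ᵥ-comm _ u ⟩
      addV u (scaleV (- i) v)                                ≡⟨ sym (subV-scaleV u i v) ⟩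
      subV F S u (scaleV i v)                                ∎

  greedyHyperplane : (K : Pred) (v : A) (H : Pred) → List A → Pred
  greedyHyperplane K v H []       = H
  greedyHyperplane K v H (w ∷ ws) =
    if K w ∧ not ((H +⟨ w ⟩) v) then greedyHyperplane K v (H +⟨ w ⟩) ws else greedyHyperplane K v H ws

  record GreedyInvariant (K : Pred) (v : A) (H₀ H : Pred) (ws : List A) : Set where
    field
      isSub  : IsSub H
      H₀⊆H   : H₀ ⊆ H
      H⊆K    : H ⊆ K
      v∉H    : H v ≡ false
      covers : ∀ w → w ∈ ws → K w ≡ true → H w ≡ true ⊎ (H +⟨ w ⟩) v ≡ true

  greedy-invariant : ∀ {K} → IsSub K → ∀ v ws H₀ → IsSub H₀ → H₀ ⊆ K → H₀ v ≡ false →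
    GreedyInvariant K v H₀ (greedyHyperplane K v H₀ ws) ws
  greedy-invariant sK v [] H₀ sH₀ H₀⊆K v∉H₀ =
    record { isSub = sH₀ ; H₀⊆H = λ _ h → h ; H⊆K = H₀⊆K ; v∉H = v∉H₀ ; covers = λ _ () }
  greedy-invariant {K} sK v (w ∷ ws) H₀ sH₀ H₀⊆K v∉H₀ with K w ∧ not ((H₀ +⟨ w ⟩) v) in added
  ... | true = record { isSub = I.isSub ; H₀⊆H = λ u h → I.H₀⊆H u (+⟨⟩-⊇ H₀ w u h)
                      ; H⊆K = I.H⊆K ; v∉H = I.v∉H ; covers = covers }
    where
    w∈K : K w ≡ true
    w∈K = ∧-conicalˡ _ _ added
    v∉H₀+w : (H₀ +⟨ w ⟩) v ≡ false
    v∉H₀+w = not-injective (∧-conicalʳ (K w) _ added)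
    module I = GreedyInvariant (greedy-invariant sK v ws (H₀ +⟨ w ⟩) (+⟨⟩-isSub sH₀ w) (+⟨⟩-least sK H₀⊆K w∈K) v∉H₀+w)
    covers : ∀ u → u ∈ w ∷ ws → K u ≡ true → _ ⊎ _
    covers u (here refl) _ = inj₁ (I.H₀⊆H u (+⟨⟩-∋ sH₀ u))
    covers u (there u∈) u∈K = I.covers u u∈ u∈K
  ... | false = record { isSub = I.isSub ; H₀⊆H = I.H₀⊆H ; H⊆K = I.H⊆K ; v∉H = I.v∉H ; covers = covers }
    where
    module I = GreedyInvariant (greedy-invariant sK v ws H₀ sH₀ H₀⊆K v∉H₀)
    covers : ∀ u → u ∈ w ∷ ws → K u ≡ true → _ ⊎ _
    covers u (here refl) u∈K = inj₂ (+⟨⟩-mono I.H₀⊆H u v (skipped (K u) u∈K added))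
      where
      skipped : ∀ b → b ≡ true → (b ∧ not ((H₀ +⟨ u ⟩) v)) ≡ false → (H₀ +⟨ u ⟩) v ≡ true
      skipped true refl h = not-injective h
    covers u (there u∈) u∈K = I.covers u u∈ u∈K

  record Hyperplane (X K : Pred) : Set where
    field
      H           : Pred
      H-isSub     : IsSub H
      X⊆H         : X ⊆ H
      H⊆K         : H ⊆ K
      K⊆H+⟨w⟩     : ∀ w → K w ≡ true → H w ≡ false → K ⊆ (H +⟨ w ⟩)
      count-K     : count K ≡ q ℕ.* count H

  hyperplane : ∀ {X K} → IsSub X → IsSub K → X ⊆ K → ∀ v → K v ≡ true → X v ≡ false → Hyperplane X K
  hyperplane {X} {K} sX sK X⊆K v v∈K v∉X = record
    { H = H ; H-isSub = I.isSub ; X⊆H = I.H₀⊆H ; H⊆K = I.H⊆K ; K⊆H+⟨w⟩ = K⊆H+w ; count-K = count-K }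
    where
    H = greedyHyperplane K v X allV
    module I = GreedyInvariant (greedy-invariant sK v allV X sX X⊆K v∉X)
    K⊆H+v : K ⊆ (H +⟨ v ⟩)
    K⊆H+v u u∈K with I.covers u (allV-complete u) u∈K
    ... | inj₁ u∈H = +⟨⟩-⊇ H v u u∈H
    ... | inj₂ v∈H+u = +⟨⟩-exchange I.isSub I.v∉H v∈H+u
    count-K : count K ≡ q ℕ.* count H
    count-K = trans (count-cong K (H +⟨ v ⟩) (≗-by-⊆ K⊆H+v (+⟨⟩-least sK I.H⊆K v∈K))) (count-+⟨⟩ I.isSub I.v∉H)
    K⊆H+w : ∀ w → K w ≡ true → H w ≡ false → K ⊆ (H +⟨ w ⟩)
    K⊆H+w w w∈K w∉H = count-≤⇒⊇ (+⟨⟩-least sK I.H⊆K w∈K) (ℕP.≤-reflexive (trans count-K (sym (count-+⟨⟩ I.isSub w∉H))))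

  +⟨⟩-∩ : ∀ {B H} → IsSub H → B ⊆ H → ∀ {w u} → H w ≡ false → (B +⟨ w ⟩) u ≡ true → H u ≡ true → B u ≡ true
  +⟨⟩-∩ {B} {H} sH B⊆H {w} {u} w∉H u∈B+w u∈H with any-elim _ elements u∈B+w
  ... | a , _ , pa = transport B (trans (cong (λ c → subV F S u (scaleV c w)) a≡0) (subV-0· u w)) pa
    where
    a≡0 : a ≡ 0#
    a≡0 = +⟨⟩-coefficient-unique sH w∉H u a 0# (B⊆H _ pa) (transport H (sym (subV-0· u w)) u∈H)

module Instances (F : FiniteField) where
  open FiniteField F using (_+_; _*_; 0#; elements; complete; unique)
  open FieldProperties F

  fieldLaws : VectorLaws F _+_ _*_ 0#
  fieldLaws = record
    { +-assoc = +-assoc ; +-comm = +-comm ; +-identityˡ = +-identityˡ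
    ; ·-identity = *-identityˡ ; ·-assoc = *-assoc ; ·-distribˡ = distribˡ
    ; ·-distribʳ = λ a b v → distribʳ v a b ; ·-zeroˡ = zeroˡ }

  vecLaws : ∀ {B addB scaleB zeroB} → VectorLaws F {B} addB scaleB zeroB → ∀ n →
    VectorLaws F (zipWith addB) (λ a → Vec.map (scaleB a)) (Vec.replicate n zeroB)
  vecLaws {B} {addB} {scaleB} {zeroB} M n = record
    { +-assoc     = zipWith-assoc M.+-assoc
    ; +-comm      = zipWith-comm M.+-comm
    ; +-identityˡ = zipWith-identityˡ M.+-identityˡ
    ; ·-identity  = λ v → trans (map-cong M.·-identity v) (map-id v)
    ; ·-assoc     = λ a b v → trans (map-cong (M.·-assoc a b) v) (map-∘ (scaleB a) (scaleB b) v)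
    ; ·-distribˡ  = distribˡ′
    ; ·-distribʳ  = distribʳ′
    ; ·-zeroˡ     = λ v → trans (map-cong M.·-zeroˡ v) (map-const v zeroB) }
    where
    module M = VectorLaws M
    distribˡ′ : ∀ {n} a (u v : Vec B n) →
      Vec.map (scaleB a) (zipWith addB u v) ≡ zipWith addB (Vec.map (scaleB a) u) (Vec.map (scaleB a) v)
    distribˡ′ a []      []      = refl
    distribˡ′ a (x ∷ u) (y ∷ v) = cong₂ _∷_ (M.·-distribˡ a x y) (distribˡ′ a u v)
    distribʳ′ : ∀ {n} a b (v : Vec B n) →
      Vec.map (scaleB (a + b)) v ≡ zipWith addB (Vec.map (scaleB a) v) (Vec.map (scaleB b) v)
    distribʳ′ a b []      = refl
    distribʳ′ a b (x ∷ v) = cong₂ _∷_ (M.·-distribʳ a b x) (distribʳ′ a b v)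

  allVecs-complete : ∀ n (v : Vect F n) → v ∈ allVecs F n
  allVecs-complete = allVecsOf-complete elements complete

  allVecs-unique : ∀ n → Unique (allVecs F n)
  allVecs-unique = allVecsOf-unique elements unique

  FqN-isFinVectorSpace : ∀ n → IsFinVectorSpace F (FqN F n)
  FqN-isFinVectorSpace n = record
    { allV-unique = allVecs-unique n ; allV-complete = allVecs-complete n ; vectorLaws = vecLaws fieldLaws n }

  MatSp-isFinVectorSpace : ∀ n m → IsFinVectorSpace F (MatSp F n m)
  MatSp-isFinVectorSpace n m = record
    { allV-unique   = allVecsOf-unique (allVecs F m) (allVecs-unique m) n
    ; allV-complete = allVecsOf-complete (allVecs F m) (allVecs-complete m) n
    ; vectorLaws    = vecLaws (vecLaws fieldLaws m) n }

allᵇ : ∀ {A : Set} {t} → (A → Bool) → Vec A t → Bool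
allᵇ p bs = Vec.foldr _ (λ b r → p b ∧ r) true bs

count-tuples : ∀ {A : Set} (p : A → Bool) (xs : List A) t →
  ℕΣ.Σ (λ bs → ℕΣ.ind (allᵇ p bs) 1) (allVecsOf xs t) ≡ ℕΣ.Σ (λ x → ℕΣ.ind (p x) 1) xs ℕ.^ t
count-tuples p xs zero    = refl
count-tuples p xs (suc t) = begin
  ℕΣ.Σ (λ bs → ℕΣ.ind (allᵇ p bs) 1) (concatMap (λ a → map (a ∷_) (allVecsOf xs t)) xs)
    ≡⟨ ℕΣ.Σ-concatMap _ _ xs ⟩
  ℕΣ.Σ (λ a → ℕΣ.Σ (λ bs → ℕΣ.ind (allᵇ p bs) 1) (map (a ∷_) (allVecsOf xs t))) xs
    ≡⟨ ℕΣ.Σ-cong xs (λ a → trans (ℕΣ.Σ-map _ (a ∷_) (allVecsOf xs t)) (headCount a)) ⟩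
  ℕΣ.Σ (λ a → c ℕ.^ t ℕ.* ℕΣ.ind (p a) 1) xs
    ≡⟨ ℕΣ.Σ-⊗ˡ (c ℕ.^ t) _ xs ⟩
  c ℕ.^ t ℕ.* c
    ≡⟨ ℕP.*-comm (c ℕ.^ t) c ⟩
  c ℕ.^ suc t ∎
  where
  open ≡-Reasoning
  c = ℕΣ.Σ (λ x → ℕΣ.ind (p x) 1) xs
  headCount : ∀ a → ℕΣ.Σ (λ bs → ℕΣ.ind (p a ∧ allᵇ p bs) 1) (allVecsOf xs t) ≡ c ℕ.^ t ℕ.* ℕΣ.ind (p a) 1
  headCount a with p a
  ... | true  = trans (count-tuples p xs t) (sym (ℕP.*-identityʳ _))
  ... | false = trans (ℕΣ.Σ-𝟘 (allVecsOf xs t)) (sym (ℕP.*-zeroʳ (c ℕ.^ t)))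

-- The lattice of subspaces and its Möbius function

module SubspaceLattice (F : FiniteField) {A : Set} (S : FinSpace F A) (isFVS : IsFinVectorSpace F S) where
  open FiniteField F using (elements; complete)
  open FinSpace S public
  open FinVectorSpace F S isFVS public

  𝓛 : List (List A)
  𝓛 = subspaces F S

  listOf : Pred → List A
  listOf P = filterᵇ P allV

  _≤ᵇ_ : List A → List A → Bool
  X ≤ᵇ Y = subᵇ F S X Y

  dimS : List A → ℕ
  dimS X = dim F S X

  ⟦_⟧ : List A → Pred
  ⟦ X ⟧ v = mem v X

  mem⁺ : ∀ {v} X → v ∈ X → ⟦ X ⟧ v ≡ true
  mem⁺ X = memBy⁺ eqV {xs = X}

  mem⁻ : ∀ {v} X → ⟦ X ⟧ v ≡ true → v ∈ X
  mem⁻ X = memBy⁻ eqV {xs = X}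

  ≤ᵇ-intro : ∀ X Y → ⟦ X ⟧ ⊆ ⟦ Y ⟧ → X ≤ᵇ Y ≡ true
  ≤ᵇ-intro X Y X⊆Y = all-intro ⟦ Y ⟧ X (λ v v∈X → X⊆Y v (mem⁺ X v∈X))

  ≤ᵇ-elim : ∀ X Y → X ≤ᵇ Y ≡ true → ⟦ X ⟧ ⊆ ⟦ Y ⟧
  ≤ᵇ-elim X Y X≤Y v v∈X = all-elim ⟦ Y ⟧ X X≤Y v (mem⁻ X v∈X)

  ≤ᵇ-false-elim : ∀ X Y → X ≤ᵇ Y ≡ false → ∃ λ v → ⟦ X ⟧ v ≡ true × ⟦ Y ⟧ v ≡ false
  ≤ᵇ-false-elim X Y X≰Y with all-false ⟦ Y ⟧ X X≰Y
  ... | v , v∈X , v∉Y = v , mem⁺ X v∈X , v∉Y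

  ≤ᵇ-false-intro : ∀ X Y v → ⟦ X ⟧ v ≡ true → ⟦ Y ⟧ v ≡ false → X ≤ᵇ Y ≡ false
  ≤ᵇ-false-intro X Y v v∈X v∉Y with X ≤ᵇ Y in X≤Y
  ... | false = refl
  ... | true with trans (sym v∉Y) (≤ᵇ-elim X Y X≤Y v v∈X)
  ...   | ()

  ≤ᵇ-refl : ∀ X → X ≤ᵇ X ≡ true
  ≤ᵇ-refl X = ≤ᵇ-intro X X (λ _ h → h)

  -- Characterises the elements of 𝓛: subspaces listed in the order of allV.
  record InLattice (X : List A) : Set where
    field
      canonical : X ≡ listOf ⟦ X ⟧
      isSub     : IsSub ⟦ X ⟧

  listOf-InLattice : ∀ {P} → IsSub P → InLattice (listOf P)
  listOf-InLattice {P} sP = record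
    { canonical = filterᵇ-cong P (λ v → mem v (listOf P)) allV (λ v _ → sym (mem-filterᵇ P v))
    ; isSub     = IsSub-cong (λ v → sym (mem-filterᵇ P v)) sP }

  InLattice-ext : ∀ {X Y} → InLattice X → InLattice Y → (∀ v → ⟦ X ⟧ v ≡ ⟦ Y ⟧ v) → X ≡ Y
  InLattice-ext {X} {Y} lX lY X≗Y =
    trans (InLattice.canonical lX) (trans (filterᵇ-cong _ _ allV (λ v _ → X≗Y v)) (sym (InLattice.canonical lY)))

  isSubspaceᵇ-intro : ∀ X → IsSub ⟦ X ⟧ → isSubspaceᵇ F S X ≡ true
  isSubspaceᵇ-intro X sX = cong₂ _∧_ zero∈ (cong₂ _∧_
    (all-intro _ X (λ u u∈ → all-intro _ X (λ v v∈ → +-closed {u} {v} (mem⁺ X u∈) (mem⁺ X v∈))))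
    (all-intro _ elements (λ a _ → all-intro _ X (λ v v∈ → ·-closed a {v} (mem⁺ X v∈)))))
    where open IsSub sX

  isSubspaceᵇ-elim : ∀ X → isSubspaceᵇ F S X ≡ true → IsSub ⟦ X ⟧
  isSubspaceᵇ-elim X h = record
    { zero∈    = ∧-conicalˡ _ _ h
    ; +-closed = λ {u} {v} u∈ v∈ → all-elim _ X (all-elim _ X +closed u (mem⁻ X u∈)) v (mem⁻ X v∈)
    ; ·-closed = λ a {v} v∈ → all-elim _ X (all-elim _ elements ·closed a (complete a)) v (mem⁻ X v∈) }
    where
    closure = ∧-conicalʳ (mem zeroV X) _ h
    +closed = ∧-conicalˡ _ _ closure
    ·closed = ∧-conicalʳ (all (λ u → all (λ v → mem (addV u v) X) X) X) _ closure

  ∈𝓛⇒InLattice : ∀ {X} → X ∈ 𝓛 → InLattice X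
  ∈𝓛⇒InLattice {X} X∈ with ∈-filterᵇ⁻ (isSubspaceᵇ F S) {X} {sublists allV} X∈
  ... | X∈sublists , isSubX = record
    { canonical = sublist-canonical eqV allV allV-unique X∈sublists ; isSub = isSubspaceᵇ-elim X isSubX }

  InLattice⇒∈𝓛 : ∀ {X} → InLattice X → X ∈ 𝓛
  InLattice⇒∈𝓛 {X} lX = subst (_∈ 𝓛) (sym canonical)
    (∈-filterᵇ⁺ (isSubspaceᵇ F S) (∈-sublists-filterᵇ ⟦ X ⟧ allV)
      (isSubspaceᵇ-intro (listOf ⟦ X ⟧) (InLattice.isSub (subst InLattice canonical lX))))
    where open InLattice lX

  𝓛-unique : Unique 𝓛
  𝓛-unique = filterᵇ-unique (isSubspaceᵇ F S) (sublists-unique allV allV-unique)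

  count≡q^dimS : ∀ {X} → InLattice X → count ⟦ X ⟧ ≡ q ℕ.^ dimS X
  count≡q^dimS {X} lX = trans (count≡q^dim (InLattice.isSub lX)) (cong (λ L → q ℕ.^ dim F S L) (sym (InLattice.canonical lX)))

  dimS-mono : ∀ {X Y} → InLattice X → InLattice Y → ⟦ X ⟧ ⊆ ⟦ Y ⟧ → dimS X ℕ.≤ dimS Y
  dimS-mono lX lY X⊆Y = q^-reflect-≤ (subst₂ ℕ._≤_ (count≡q^dimS lX) (count≡q^dimS lY) (count-mono X⊆Y))

μq : ℕ → ℕ → ℤ
μq q d = ((ℤ.- + 1) ^ℤ d) ℤ.* (+ (q ℕ.^ (d choose 2)))

+-^ℤ : ∀ a k → (+ a) ^ℤ k ≡ + (a ℕ.^ k)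
+-^ℤ a zero    = refl
+-^ℤ a (suc k) = trans (cong (ℤ._*_ (+ a)) (+-^ℤ a k)) (sym (ℤP.pos-* a (a ℕ.^ k)))

μq-suc : ∀ q d → μq q (suc d) ≡ ℤ.- (+ (q ℕ.^ d)) ℤ.* μq q d
μq-suc q d = begin
  ((ℤ.- + 1) ℤ.* s) ℤ.* (+ (q ℕ.^ (suc d choose 2)))                ≡⟨ cong (λ e → ((ℤ.- + 1) ℤ.* s) ℤ.* (+ (q ℕ.^ e))) sucC2 ⟩
  ((ℤ.- + 1) ℤ.* s) ℤ.* (+ (q ℕ.^ (d ℕ.+ d choose 2)))              ≡⟨ cong (λ e → ((ℤ.- + 1) ℤ.* s) ℤ.* (+ e)) (ℕP.^-distribˡ-+-* q d (d choose 2)) ⟩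
  ((ℤ.- + 1) ℤ.* s) ℤ.* (+ (q ℕ.^ d ℕ.* q ℕ.^ (d choose 2)))        ≡⟨ cong (ℤ._*_ ((ℤ.- + 1) ℤ.* s)) (ℤP.pos-* (q ℕ.^ d) _) ⟩
  ((ℤ.- + 1) ℤ.* s) ℤ.* ((+ (q ℕ.^ d)) ℤ.* (+ (q ℕ.^ (d choose 2)))) ≡⟨ rearrange s (+ (q ℕ.^ d)) (+ (q ℕ.^ (d choose 2))) ⟩
  ℤ.- (+ (q ℕ.^ d)) ℤ.* μq q d                                 ∎
  where
  open ≡-Reasoning
  s = (ℤ.- + 1) ^ℤ d
  sucC2 : suc d choose 2 ≡ d ℕ.+ d choose 2
  sucC2 = trans (sym (nCk+nC[k+1]≡[n+1]C[k+1] d 1)) (cong (ℕ._+ d choose 2) (nC1≡n d))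
  rearrange : ∀ (s P Q : ℤ) → ((ℤ.- + 1) ℤ.* s) ℤ.* (P ℤ.* Q) ≡ ℤ.- P ℤ.* (s ℤ.* Q)
  rearrange = solve-∀

μq-step : ∀ q {x b h} → x ℕ.≤ b → b ℕ.≤ h →
  (+ (q ℕ.^ (h ∸ b))) ℤ.* μq q (suc b ∸ x) ≡ ℤ.- (+ (q ℕ.^ (h ∸ x))) ℤ.* μq q (b ∸ x)
μq-step q {x} {b} {h} x≤b b≤h = begin
  Q[h-b] ℤ.* μq q (suc b ∸ x)                           ≡⟨ cong (λ e → Q[h-b] ℤ.* μq q e) (ℕP.+-∸-assoc 1 x≤b) ⟩
  Q[h-b] ℤ.* μq q (suc (b ∸ x))                         ≡⟨ cong (ℤ._*_ Q[h-b]) (μq-suc q (b ∸ x)) ⟩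
  Q[h-b] ℤ.* (ℤ.- (+ (q ℕ.^ (b ∸ x))) ℤ.* M)            ≡⟨ rearrange Q[h-b] (+ (q ℕ.^ (b ∸ x))) M ⟩
  ℤ.- (Q[h-b] ℤ.* (+ (q ℕ.^ (b ∸ x)))) ℤ.* M            ≡⟨ cong (λ e → ℤ.- e ℤ.* M) (ℤP.pos-* (q ℕ.^ (h ∸ b)) _) ⟨
  ℤ.- (+ (q ℕ.^ (h ∸ b) ℕ.* q ℕ.^ (b ∸ x))) ℤ.* M       ≡⟨ cong (λ e → ℤ.- (+ e) ℤ.* M) (ℕP.^-distribˡ-+-* q (h ∸ b) (b ∸ x)) ⟨
  ℤ.- (+ (q ℕ.^ ((h ∸ b) ℕ.+ (b ∸ x)))) ℤ.* M           ≡⟨ cong (λ e → ℤ.- (+ (q ℕ.^ e)) ℤ.* M) ∸-telescope ⟩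
  ℤ.- (+ (q ℕ.^ (h ∸ x))) ℤ.* M                         ∎
  where
  open ≡-Reasoning
  Q[h-b] = + (q ℕ.^ (h ∸ b))
  M = μq q (b ∸ x)
  rearrange : ∀ (a p m : ℤ) → a ℤ.* (ℤ.- p ℤ.* m) ≡ ℤ.- (a ℤ.* p) ℤ.* m
  rearrange = solve-∀
  ∸-telescope : (h ∸ b) ℕ.+ (b ∸ x) ≡ h ∸ x
  ∸-telescope = trans (sym (ℕP.+-∸-assoc (h ∸ b) x≤b)) (cong (_∸ x) (ℕP.m∸n+n≡m b≤h))

-- Both y and c equal k / (q - 1).
excess-cancel : ∀ {q k y c} → 2 ℕ.≤ q → k ℕ.+ y ≡ q ℕ.* y → c ℕ.+ k ≡ q ℕ.* c → y ≡ c
excess-cancel {q} {k} {y} {c} 2≤q k+y≡qy c+k≡qc =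
  ℕP.*-cancelˡ-≡ y c (q ∸ 1) ⦃ ℕ.>-nonZero (ℕP.∸-monoˡ-≤ 1 2≤q) ⦄ (trans (sym (k≡[q-1]* y (k+y≡qy))) (k≡[q-1]* c (trans (ℕP.+-comm k c) c+k≡qc)))
  where
  k≡[q-1]* : ∀ z → k ℕ.+ z ≡ q ℕ.* z → k ≡ (q ∸ 1) ℕ.* z
  k≡[q-1]* z e = begin
    k                      ≡⟨ ℕP.m+n∸n≡m k z ⟨
    (k ℕ.+ z) ∸ z          ≡⟨ cong (_∸ z) e ⟩
    q ℕ.* z ∸ z            ≡⟨ cong (q ℕ.* z ∸_) (ℕP.*-identityˡ z) ⟨
    q ℕ.* z ∸ 1 ℕ.* z      ≡⟨ ℕP.*-distribʳ-∸ z q 1 ⟨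
    (q ∸ 1) ℕ.* z          ∎
    where open ≡-Reasoning

module Möbius (F : FiniteField) {A : Set} (S : FinSpace F A) (isFVS : IsFinVectorSpace F S) where
  open SubspaceLattice F S isFVS
  open FiniteField F using (-_; 1#; elements)

  μS : List A → List A → ℤ
  μS X Y = μq q (dimS Y ∸ dimS X)

  Σμ : List A → List A → ℤ
  Σμ X K = ℤΣ.Σ (λ Y → ℤΣ.ind (X ≤ᵇ Y ∧ Y ≤ᵇ K) (μS X Y)) 𝓛

  q^-divide : ∀ {f b h} → b ℕ.≤ h → f ℕ.* q ℕ.^ b ≡ q ℕ.^ h → f ≡ q ℕ.^ (h ∸ b)
  q^-divide {f} {b} {h} b≤h e = ℕP.*-cancelʳ-≡ f (q ℕ.^ (h ∸ b)) (q ℕ.^ b) ⦃ ℕ.>-nonZero (q^-pos b) ⦄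
    (trans e (trans (cong (q ℕ.^_) (sym (ℕP.m∸n+n≡m b≤h))) (ℕP.^-distribˡ-+-* q (h ∸ b) b)))

  module HyperplaneStep {X K : List A} (lX : InLattice X) (lK : InLattice K) (hp : Hyperplane ⟦ X ⟧ ⟦ K ⟧) where
    open Hyperplane hp

    Hᴸ : List A
    Hᴸ = listOf H

    lH : InLattice Hᴸ
    lH = listOf-InLattice H-isSub

    ∈Hᴸ : ∀ v → ⟦ Hᴸ ⟧ v ≡ H v
    ∈Hᴸ = mem-filterᵇ H

    x h : ℕ
    x = dimS X
    h = dimS Hᴸ

    outside : List A → Bool
    outside Y = X ≤ᵇ Y ∧ (Y ≤ᵇ K ∧ not (Y ≤ᵇ Hᴸ))

    _∩H : List A → List A
    Y ∩H = listOf (λ u → ⟦ Y ⟧ u ∧ H u)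

    _≈ᵇ_ : List A → List A → Bool
    B ≈ᵇ Y = B ≤ᵇ Y ∧ Y ≤ᵇ B

    _⋖_ : List A → List A → Bool
    B ⋖ Y = outside Y ∧ B ≈ᵇ (Y ∩H)

    ≈ᵇ-elim : ∀ B Y → B ≈ᵇ Y ≡ true → ∀ v → ⟦ B ⟧ v ≡ ⟦ Y ⟧ v
    ≈ᵇ-elim B Y e = ≗-by-⊆ (≤ᵇ-elim B Y (∧-conicalˡ _ _ e)) (≤ᵇ-elim Y B (∧-conicalʳ (B ≤ᵇ Y) _ e))

    ≈ᵇ-intro : ∀ B Y → (∀ v → ⟦ B ⟧ v ≡ ⟦ Y ⟧ v) → B ≈ᵇ Y ≡ true
    ≈ᵇ-intro B Y B≗Y = cong₂ _∧_ (≤ᵇ-intro B Y (λ v e → trans (sym (B≗Y v)) e)) (≤ᵇ-intro Y B (λ v e → trans (B≗Y v) e))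

    interval-split : ∀ Y (m : ℤ) →
      ℤΣ.ind (X ≤ᵇ Y ∧ Y ≤ᵇ K) m ≡ ℤΣ.ind (X ≤ᵇ Y ∧ Y ≤ᵇ Hᴸ) m ℤ.+ ℤΣ.ind (outside Y) m
    interval-split Y m with X ≤ᵇ Y
    ... | false = refl
    ... | true with Y ≤ᵇ Hᴸ in Y≤H
    ...   | true rewrite ≤ᵇ-intro Y K (λ v v∈Y → H⊆K v (trans (sym (∈Hᴸ v)) (≤ᵇ-elim Y Hᴸ Y≤H v v∈Y))) = sym (ℤP.+-identityʳ m)
    ...   | false with Y ≤ᵇ K
    ...     | true  = sym (ℤP.+-identityˡ m)
    ...     | false = refl

    record Over (B Y : List A) : Set where
      field
        X⊆Y   : ⟦ X ⟧ ⊆ ⟦ Y ⟧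
        Y⊆K   : ⟦ Y ⟧ ⊆ ⟦ K ⟧
        w     : A
        w∈Y   : ⟦ Y ⟧ w ≡ true
        w∉H   : H w ≡ false
        B≗Y∩H : ∀ u → ⟦ B ⟧ u ≡ (⟦ Y ⟧ u ∧ H u)

      X⊆B : ⟦ X ⟧ ⊆ ⟦ B ⟧
      X⊆B u u∈X = trans (B≗Y∩H u) (cong₂ _∧_ (X⊆Y u u∈X) (X⊆H u u∈X))

      B⊆Y : ⟦ B ⟧ ⊆ ⟦ Y ⟧
      B⊆Y u u∈B = ∧-conicalˡ _ _ (trans (sym (B≗Y∩H u)) u∈B)

      B⊆H : ⟦ B ⟧ ⊆ H
      B⊆H u u∈B = ∧-conicalʳ (⟦ Y ⟧ u) _ (trans (sym (B≗Y∩H u)) u∈B)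

    ⋖-elim : ∀ B Y → B ⋖ Y ≡ true → Over B Y
    ⋖-elim B Y B⋖Y = record
      { X⊆Y = ≤ᵇ-elim X Y (∧-conicalˡ _ _ outsideY) ; Y⊆K = ≤ᵇ-elim Y K (∧-conicalˡ _ _ Y≤K∧Y≰H)
      ; w = w ; w∈Y = w∈Y ; w∉H = trans (sym (∈Hᴸ w)) w∉Hᴸ
      ; B≗Y∩H = λ u → trans (≈ᵇ-elim B (Y ∩H) (∧-conicalʳ (outside Y) _ B⋖Y) u) (mem-filterᵇ (λ u → ⟦ Y ⟧ u ∧ H u) u) }
      where
      outsideY = ∧-conicalˡ _ _ B⋖Y
      Y≤K∧Y≰H = ∧-conicalʳ (X ≤ᵇ Y) _ outsideY
      Y≰H = not-injective (∧-conicalʳ (Y ≤ᵇ K) _ Y≤K∧Y≰H)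
      w = proj₁ (≤ᵇ-false-elim Y Hᴸ Y≰H)
      w∈Y = proj₁ (proj₂ (≤ᵇ-false-elim Y Hᴸ Y≰H))
      w∉Hᴸ = proj₂ (proj₂ (≤ᵇ-false-elim Y Hᴸ Y≰H))

    -- As K = H + ⟨w′⟩, each u ∈ Y is b + a w′ with b = u - a w′ ∈ Y ∩ H = B.
    Over-≗ : ∀ {B Y} → InLattice Y → Over B Y → ∀ w′ → ⟦ Y ⟧ w′ ≡ true → H w′ ≡ false →
      ∀ u → ⟦ Y ⟧ u ≡ (⟦ B ⟧ +⟨ w′ ⟩) u
    Over-≗ {B} {Y} lY o w′ w′∈Y w′∉H = ≗-by-⊆ Y⊆B+w′ (+⟨⟩-least sY B⊆Y w′∈Y)
      where
      open Over o
      sY = InLattice.isSub lY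
      Y⊆B+w′ : ⟦ Y ⟧ ⊆ (⟦ B ⟧ +⟨ w′ ⟩)
      Y⊆B+w′ u u∈Y with any-elim _ elements (K⊆H+⟨w⟩ w′ (Y⊆K w′ w′∈Y) w′∉H u (Y⊆K u u∈Y))
      ... | a , _ , pa = +⟨⟩-intro ⟦ B ⟧ w′ u a (trans (B≗Y∩H _) (cong₂ _∧_
              (IsSub.+-closed sY u∈Y (IsSub.·-closed sY (- 1#) (IsSub.·-closed sY a w′∈Y))) pa))

    module Extension {B : List A} (lB : InLattice B) (X⊆B : ⟦ X ⟧ ⊆ ⟦ B ⟧) (B⊆H : ⟦ B ⟧ ⊆ H)
                {w : A} (w∈K : ⟦ K ⟧ w ≡ true) (w∉H : H w ≡ false) where

      B+w : List A
      B+w = listOf (⟦ B ⟧ +⟨ w ⟩)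

      lB+w : InLattice B+w
      lB+w = listOf-InLattice (+⟨⟩-isSub (InLattice.isSub lB) w)

      ∈B+w : ∀ u → ⟦ B+w ⟧ u ≡ (⟦ B ⟧ +⟨ w ⟩) u
      ∈B+w = mem-filterᵇ (⟦ B ⟧ +⟨ w ⟩)

      w∈B+w : ⟦ B+w ⟧ w ≡ true
      w∈B+w = trans (∈B+w w) (+⟨⟩-∋ (InLattice.isSub lB) w)

      B≗B+w∩H : ∀ u → ⟦ B ⟧ u ≡ (⟦ B+w ⟧ u ∧ H u)
      B≗B+w∩H u = ≡-by-⇔
        (λ u∈B → cong₂ _∧_ (trans (∈B+w u) (+⟨⟩-⊇ ⟦ B ⟧ w u u∈B)) (B⊆H u u∈B))
        (λ u∈B+w∩H → +⟨⟩-∩ H-isSub B⊆H w∉H (trans (sym (∈B+w u)) (∧-conicalˡ _ _ u∈B+w∩H))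
                                            (∧-conicalʳ (⟦ B+w ⟧ u) _ u∈B+w∩H))

      B⋖B+w : B ⋖ B+w ≡ true
      B⋖B+w = cong₂ _∧_
        (cong₂ _∧_ (≤ᵇ-intro X B+w (λ u u∈X → trans (∈B+w u) (+⟨⟩-⊇ ⟦ B ⟧ w u (X⊆B u u∈X))))
                   (cong₂ _∧_ (≤ᵇ-intro B+w K (λ u u∈ → +⟨⟩-least (InLattice.isSub lK) (λ v v∈B → H⊆K v (B⊆H v v∈B)) w∈K u
                                                           (trans (sym (∈B+w u)) u∈)))
                              (cong not (≤ᵇ-false-intro B+w Hᴸ w w∈B+w (trans (∈Hᴸ w) w∉H)))))
        (≈ᵇ-intro B (B+w ∩H) (λ u → trans (B≗B+w∩H u) (sym (mem-filterᵇ (λ u → ⟦ B+w ⟧ u ∧ H u) u))))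

    outside-as-Σ : ∀ Y → Y ∈ 𝓛 → ℤΣ.ind (outside Y) (μS X Y) ≡ ℤΣ.Σ (λ B → ℤΣ.ind (B ⋖ Y) (μS X Y)) 𝓛
    outside-as-Σ Y Y∈ with outside Y
    ... | false = sym (ℤΣ.Σ-𝟘 𝓛)
    ... | true  = sym (ℤΣ.Σ-ind-singleton (λ B → B ≈ᵇ (Y ∩H)) (λ _ → μS X Y) 𝓛 𝓛-unique
                    (InLattice⇒∈𝓛 lY∩H) (≈ᵇ-intro (Y ∩H) (Y ∩H) (λ _ → refl))
                    (λ B B∈ e → InLattice-ext (∈𝓛⇒InLattice B∈) lY∩H (≈ᵇ-elim B (Y ∩H) e)))
      where
      lY∩H : InLattice (Y ∩H)
      lY∩H = listOf-InLattice (∩-isSub (InLattice.isSub (∈𝓛⇒InLattice Y∈)) H-isSub)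
        where
        ∩-isSub : ∀ {P Q} → IsSub P → IsSub Q → IsSub (λ u → P u ∧ Q u)
        ∩-isSub {P} {Q} sP sQ = record
          { zero∈    = cong₂ _∧_ (IsSub.zero∈ sP) (IsSub.zero∈ sQ)
          ; +-closed = λ {u} {v} pu pv → cong₂ _∧_ (IsSub.+-closed sP (∧-conicalˡ _ _ pu) (∧-conicalˡ _ _ pv))
                                                   (IsSub.+-closed sQ (∧-conicalʳ (P u) _ pu) (∧-conicalʳ (P v) _ pv))
          ; ·-closed = λ a {v} pv → cong₂ _∧_ (IsSub.·-closed sP a (∧-conicalˡ _ _ pv)) (IsSub.·-closed sQ a (∧-conicalʳ (P v) _ pv)) }

    module Fibre {B : List A} (lB : InLattice B) (X⊆B : ⟦ X ⟧ ⊆ ⟦ B ⟧) (B⊆H : ⟦ B ⟧ ⊆ H) where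

      b : ℕ
      b = dimS B

      outsideH : List A → Pred
      outsideH Y u = ⟦ Y ⟧ u ∧ not (H u)

      ∉H⇒∉B : ∀ {w} → H w ≡ false → ⟦ B ⟧ w ≡ false
      ∉H⇒∉B {w} w∉H with ⟦ B ⟧ w in w∈B
      ... | false = refl
      ... | true  = trans (sym (B⊆H w w∈B)) w∉H

      count-over : ∀ {Y} → InLattice Y → B ⋖ Y ≡ true → count ⟦ Y ⟧ ≡ q ℕ.* count ⟦ B ⟧
      count-over lY B⋖Y = trans (count-cong _ _ (Over-≗ lY o w w∈Y w∉H)) (count-+⟨⟩ (InLattice.isSub lB) (∉H⇒∉B w∉H))
        where
        o = ⋖-elim B _ B⋖Y
        open Over o using (w; w∈Y; w∉H)

      dim-over : ∀ {Y} → InLattice Y → B ⋖ Y ≡ true → dimS Y ≡ suc b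
      dim-over lY B⋖Y = q^-injective (trans (sym (count≡q^dimS lY)) (trans (count-over lY B⋖Y) (cong (q ℕ.*_) (count≡q^dimS lB))))

      count-outsideH-over : ∀ {Y} → InLattice Y → B ⋖ Y ≡ true → count (outsideH Y) ℕ.+ count ⟦ B ⟧ ≡ q ℕ.* count ⟦ B ⟧
      count-outsideH-over {Y} lY B⋖Y = begin
        count (outsideH Y) ℕ.+ count ⟦ B ⟧                          ≡⟨ cong (count (outsideH Y) ℕ.+_) (count-cong _ _ (Over.B≗Y∩H (⋖-elim B Y B⋖Y))) ⟩
        count (outsideH Y) ℕ.+ count (λ u → ⟦ Y ⟧ u ∧ H u)          ≡⟨ ℕP.+-comm (count (outsideH Y)) _ ⟩
        count (λ u → ⟦ Y ⟧ u ∧ H u) ℕ.+ count (outsideH Y)          ≡⟨ count-split ⟦ Y ⟧ H ⟨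
        count ⟦ Y ⟧                                                  ≡⟨ count-over lY B⋖Y ⟩
        q ℕ.* count ⟦ B ⟧                                            ∎
        where open ≡-Reasoning

      -- Each w ∈ K outside H lies in exactly one Y over B, namely B + ⟨w⟩.
      over-through : ∀ w → ℕΣ.Σ (λ Y → ℕΣ.ind (B ⋖ Y ∧ outsideH Y w) 1) 𝓛 ≡ ℕΣ.ind (⟦ K ⟧ w ∧ not (H w)) 1
      over-through w with ⟦ K ⟧ w ∧ not (H w) in w∈K∖H
      ... | true = ℕΣ.Σ-ind-singleton (λ Y → B ⋖ Y ∧ outsideH Y w) (λ _ → 1) 𝓛 𝓛-unique
                     (InLattice⇒∈𝓛 L.lB+w) (cong₂ _∧_ L.B⋖B+w (cong₂ _∧_ L.w∈B+w (cong not w∉H))) unique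
        where
        w∉H : H w ≡ false
        w∉H = not-injective (∧-conicalʳ (⟦ K ⟧ w) _ w∈K∖H)
        module L = Extension lB X⊆B B⊆H (∧-conicalˡ _ _ w∈K∖H) w∉H
        unique : ∀ Y → Y ∈ 𝓛 → (B ⋖ Y ∧ outsideH Y w) ≡ true → Y ≡ L.B+w
        unique Y Y∈ e = InLattice-ext lY L.lB+w (λ u → trans (Over-≗ lY (⋖-elim B Y (∧-conicalˡ _ _ e)) w
                          (∧-conicalˡ _ _ (∧-conicalʳ (B ⋖ Y) _ e)) w∉H u) (sym (L.∈B+w u)))
          where lY = ∈𝓛⇒InLattice Y∈
      ... | false = ℕΣ.Σ-ind-none (λ Y → B ⋖ Y ∧ outsideH Y w) (λ _ → 1) 𝓛 none
        where
        none : ∀ Y → Y ∈ 𝓛 → (B ⋖ Y ∧ outsideH Y w) ≡ false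
        none Y _ with B ⋖ Y in B⋖Y | ⟦ Y ⟧ w in w∈Y | H w
        ... | false | _     | _     = refl
        ... | true  | false | _     = refl
        ... | true  | true  | true  = refl
        ... | true  | true  | false = ⊥-elim (false≢true (trans (sym w∈K∖H) (cong₂ _∧_ (Over.Y⊆K (⋖-elim B Y B⋖Y) w w∈Y) refl)))

      Σ-count-outsideH : ℕΣ.Σ (λ Y → ℕΣ.ind (B ⋖ Y) (count (outsideH Y))) 𝓛 ≡ count (λ u → ⟦ K ⟧ u ∧ not (H u))
      Σ-count-outsideH = begin
        ℕΣ.Σ (λ Y → ℕΣ.ind (B ⋖ Y) (ℕΣ.Σ (λ w → ℕΣ.ind (outsideH Y w) 1) allV)) 𝓛
          ≡⟨ ℕΣ.Σ-cong 𝓛 (λ Y → ℕΣ.ind-Σ (B ⋖ Y) _ allV) ⟩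
        ℕΣ.Σ (λ Y → ℕΣ.Σ (λ w → ℕΣ.ind (B ⋖ Y) (ℕΣ.ind (outsideH Y w) 1)) allV) 𝓛
          ≡⟨ ℕΣ.Σ-swap _ 𝓛 allV ⟩
        ℕΣ.Σ (λ w → ℕΣ.Σ (λ Y → ℕΣ.ind (B ⋖ Y) (ℕΣ.ind (outsideH Y w) 1)) 𝓛) allV
          ≡⟨ ℕΣ.Σ-cong allV (λ w → trans (ℕΣ.Σ-cong 𝓛 (λ Y → sym (ℕΣ.ind-∧ (B ⋖ Y) _ 1))) (over-through w)) ⟩
        count (λ u → ⟦ K ⟧ u ∧ not (H u)) ∎
        where open ≡-Reasoning

      fibre : ℕ
      fibre = ℕΣ.Σ (λ Y → ℕΣ.ind (B ⋖ Y) 1) 𝓛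

      -- Double counting the pairs (w, Y) with w ∈ Y ∖ H, both |K ∖ H| = (q - 1) |H| and
      -- fibre · (q - 1) |B|; cancelling q - 1 needs no subtraction in this form.
      fibre·count-B : fibre ℕ.* count ⟦ B ⟧ ≡ count H
      fibre·count-B = excess-cancel 2≤q viaFibres viaK
        where
        open ≡-Reasoning
        K∖H : ℕ
        K∖H = count (λ u → ⟦ K ⟧ u ∧ not (H u))
        viaFibres : K∖H ℕ.+ fibre ℕ.* count ⟦ B ⟧ ≡ q ℕ.* (fibre ℕ.* count ⟦ B ⟧)
        viaFibres = begin
          K∖H ℕ.+ fibre ℕ.* count ⟦ B ⟧
            ≡⟨ cong₂ ℕ._+_ (sym Σ-count-outsideH) (sym (ℕΣ.Σ-ind-const (B ⋖_) (count ⟦ B ⟧) 𝓛)) ⟩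
          ℕΣ.Σ (λ Y → ℕΣ.ind (B ⋖ Y) (count (outsideH Y))) 𝓛 ℕ.+ ℕΣ.Σ (λ Y → ℕΣ.ind (B ⋖ Y) (count ⟦ B ⟧)) 𝓛
            ≡⟨ ℕΣ.Σ-⊕ _ _ 𝓛 ⟨
          ℕΣ.Σ (λ Y → ℕΣ.ind (B ⋖ Y) (count (outsideH Y)) ℕ.+ ℕΣ.ind (B ⋖ Y) (count ⟦ B ⟧)) 𝓛
            ≡⟨ ℕΣ.Σ-cong-∈ 𝓛 perY ⟩
          ℕΣ.Σ (λ Y → ℕΣ.ind (B ⋖ Y) (q ℕ.* count ⟦ B ⟧)) 𝓛
            ≡⟨ ℕΣ.Σ-ind-const (B ⋖_) (q ℕ.* count ⟦ B ⟧) 𝓛 ⟩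
          fibre ℕ.* (q ℕ.* count ⟦ B ⟧)
            ≡⟨ ℕP.*-assoc fibre q _ ⟨
          fibre ℕ.* q ℕ.* count ⟦ B ⟧
            ≡⟨ cong (ℕ._* count ⟦ B ⟧) (ℕP.*-comm fibre q) ⟩
          q ℕ.* fibre ℕ.* count ⟦ B ⟧
            ≡⟨ ℕP.*-assoc q fibre _ ⟩
          q ℕ.* (fibre ℕ.* count ⟦ B ⟧) ∎
          where
          perY : ∀ Y → Y ∈ 𝓛 → ℕΣ.ind (B ⋖ Y) (count (outsideH Y)) ℕ.+ ℕΣ.ind (B ⋖ Y) (count ⟦ B ⟧)
                                ≡ ℕΣ.ind (B ⋖ Y) (q ℕ.* count ⟦ B ⟧)
          perY Y Y∈ with B ⋖ Y in B⋖Y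
          ... | true  = count-outsideH-over (∈𝓛⇒InLattice Y∈) B⋖Y
          ... | false = refl
        viaK : count H ℕ.+ K∖H ≡ q ℕ.* count H
        viaK = begin
          count H ℕ.+ K∖H                              ≡⟨ cong (ℕ._+ K∖H) (count-cong _ _ (λ u → ≗-by-⊆ (λ v e → cong₂ _∧_ (H⊆K v e) e) (λ v e → ∧-conicalʳ (⟦ K ⟧ v) _ e) u)) ⟩
          count (λ u → ⟦ K ⟧ u ∧ H u) ℕ.+ K∖H          ≡⟨ count-split ⟦ K ⟧ H ⟨
          count ⟦ K ⟧                                  ≡⟨ count-K ⟩
          q ℕ.* count H                                ∎

      fibre≡ : fibre ≡ q ℕ.^ (h ∸ b)
      fibre≡ = q^-divide b≤h (trans (cong (fibre ℕ.*_) (sym (count≡q^dimS lB)))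
                              (trans fibre·count-B (trans (sym (count-cong _ _ ∈Hᴸ)) (count≡q^dimS lH))))
        where
        b≤h : b ℕ.≤ h
        b≤h = dimS-mono lB lH (λ u e → trans (∈Hᴸ u) (B⊆H u e))

      Σ-μ-fibre : ℤΣ.Σ (λ Y → ℤΣ.ind (B ⋖ Y) (μS X Y)) 𝓛 ≡ ℤ.- (+ (q ℕ.^ (h ∸ x))) ℤ.* μS X B
      Σ-μ-fibre = begin
        ℤΣ.Σ (λ Y → ℤΣ.ind (B ⋖ Y) (μS X Y)) 𝓛             ≡⟨ ℤΣ.Σ-cong-∈ 𝓛 dim-fibre ⟩
        ℤΣ.Σ (λ Y → ℤΣ.ind (B ⋖ Y) (μq q (suc b ∸ x))) 𝓛   ≡⟨ ℤΣ.Σ-ind-const (B ⋖_) _ 𝓛 ⟩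
        ℤΣ.Σ (λ Y → ℤΣ.ind (B ⋖ Y) (+ 1)) 𝓛 ℤ.* μq q (suc b ∸ x)
          ≡⟨ cong (ℤ._* μq q (suc b ∸ x)) (trans (ℤΣ.Σ-cong 𝓛 (λ Y → sym (+-ind (B ⋖ Y)))) (sym (+-Σ _ 𝓛))) ⟩
        + fibre ℤ.* μq q (suc b ∸ x)                       ≡⟨ cong (λ f → + f ℤ.* μq q (suc b ∸ x)) fibre≡ ⟩
        + (q ℕ.^ (h ∸ b)) ℤ.* μq q (suc b ∸ x)             ≡⟨ μq-step q (dimS-mono lX lB X⊆B) (dimS-mono lB lH (λ u e → trans (∈Hᴸ u) (B⊆H u e))) ⟩
        ℤ.- (+ (q ℕ.^ (h ∸ x))) ℤ.* μS X B                 ∎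
        where
        open ≡-Reasoning
        dim-fibre : ∀ Y → Y ∈ 𝓛 → ℤΣ.ind (B ⋖ Y) (μS X Y) ≡ ℤΣ.ind (B ⋖ Y) (μq q (suc b ∸ x))
        dim-fibre Y Y∈ with B ⋖ Y in B⋖Y
        ... | true  = cong (λ d → μq q (d ∸ x)) (dim-over (∈𝓛⇒InLattice Y∈) B⋖Y)
        ... | false = refl

    Σ-μ-over : ∀ B → B ∈ 𝓛 →
      ℤΣ.Σ (λ Y → ℤΣ.ind (B ⋖ Y) (μS X Y)) 𝓛 ≡ ℤΣ.ind (X ≤ᵇ B ∧ B ≤ᵇ Hᴸ) (ℤ.- (+ (q ℕ.^ (h ∸ x))) ℤ.* μS X B)
    Σ-μ-over B B∈ with X ≤ᵇ B ∧ B ≤ᵇ Hᴸ in X≤B≤H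
    ... | true = Fibre.Σ-μ-fibre (∈𝓛⇒InLattice B∈) (≤ᵇ-elim X B (∧-conicalˡ _ _ X≤B≤H))
                   (λ u u∈B → trans (sym (∈Hᴸ u)) (≤ᵇ-elim B Hᴸ (∧-conicalʳ (X ≤ᵇ B) _ X≤B≤H) u u∈B))
    ... | false = ℤΣ.Σ-ind-none (B ⋖_) (μS X) 𝓛 none
      where
      none : ∀ Y → Y ∈ 𝓛 → B ⋖ Y ≡ false
      none Y _ with B ⋖ Y in B⋖Y
      ... | false = refl
      ... | true  = sym (trans (sym X≤B≤H) (cong₂ _∧_ (≤ᵇ-intro X B X⊆B) (≤ᵇ-intro B Hᴸ (λ u u∈B → trans (∈Hᴸ u) (B⊆H u u∈B)))))
        where open Over (⋖-elim B Y B⋖Y)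

    Σμ-via-hyperplane : Σμ X K ≡ Σμ X Hᴸ ℤ.+ ℤ.- (+ (q ℕ.^ (h ∸ x))) ℤ.* Σμ X Hᴸ
    Σμ-via-hyperplane = begin
      Σμ X K
        ≡⟨ ℤΣ.Σ-cong 𝓛 (λ Y → interval-split Y (μS X Y)) ⟩
      ℤΣ.Σ (λ Y → ℤΣ.ind (X ≤ᵇ Y ∧ Y ≤ᵇ Hᴸ) (μS X Y) ℤ.+ ℤΣ.ind (outside Y) (μS X Y)) 𝓛
        ≡⟨ ℤΣ.Σ-⊕ _ _ 𝓛 ⟩
      Σμ X Hᴸ ℤ.+ ℤΣ.Σ (λ Y → ℤΣ.ind (outside Y) (μS X Y)) 𝓛
        ≡⟨ cong (ℤ._+_ (Σμ X Hᴸ)) outside-part ⟩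
      Σμ X Hᴸ ℤ.+ ℤ.- Q ℤ.* Σμ X Hᴸ ∎
      where
      open ≡-Reasoning
      Q = + (q ℕ.^ (h ∸ x))
      outside-part : ℤΣ.Σ (λ Y → ℤΣ.ind (outside Y) (μS X Y)) 𝓛 ≡ ℤ.- Q ℤ.* Σμ X Hᴸ
      outside-part = begin
        ℤΣ.Σ (λ Y → ℤΣ.ind (outside Y) (μS X Y)) 𝓛
          ≡⟨ ℤΣ.Σ-cong-∈ 𝓛 outside-as-Σ ⟩
        ℤΣ.Σ (λ Y → ℤΣ.Σ (λ B → ℤΣ.ind (B ⋖ Y) (μS X Y)) 𝓛) 𝓛
          ≡⟨ ℤΣ.Σ-swap (λ Y B → ℤΣ.ind (B ⋖ Y) (μS X Y)) 𝓛 𝓛 ⟩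
        ℤΣ.Σ (λ B → ℤΣ.Σ (λ Y → ℤΣ.ind (B ⋖ Y) (μS X Y)) 𝓛) 𝓛
          ≡⟨ ℤΣ.Σ-cong-∈ 𝓛 Σ-μ-over ⟩
        ℤΣ.Σ (λ B → ℤΣ.ind (X ≤ᵇ B ∧ B ≤ᵇ Hᴸ) (ℤ.- Q ℤ.* μS X B)) 𝓛
          ≡⟨ ℤΣ.Σ-cong 𝓛 (λ B → ℤΣ.ind-⊗ (X ≤ᵇ B ∧ B ≤ᵇ Hᴸ) (ℤ.- Q) (μS X B)) ⟩
        ℤΣ.Σ (λ B → ℤ.- Q ℤ.* ℤΣ.ind (X ≤ᵇ B ∧ B ≤ᵇ Hᴸ) (μS X B)) 𝓛
          ≡⟨ ℤΣ.Σ-⊗ˡ (ℤ.- Q) _ 𝓛 ⟩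
        ℤ.- Q ℤ.* Σμ X Hᴸ ∎

  -- Induction on |K|: a hyperplane H of K through X gives Σμ X K = (1 - q^(dim H - dim X)) Σμ X H,
  -- and by induction Σμ X H vanishes unless H = X, where the factor vanishes.
  Σμ-interval : ∀ {X K} → InLattice X → InLattice K → ⟦ X ⟧ ⊆ ⟦ K ⟧ → Σμ X K ≡ ℤΣ.ind (K ≤ᵇ X) (+ 1)
  Σμ-interval {X} {K} lX lK X⊆K = go (ℕ.suc (count ⟦ K ⟧)) lK X⊆K (ℕP.n<1+n _)
    where
    go : ∀ fuel {K} → InLattice K → ⟦ X ⟧ ⊆ ⟦ K ⟧ → count ⟦ K ⟧ ℕ.< fuel → Σμ X K ≡ ℤΣ.ind (K ≤ᵇ X) (+ 1)
    go (suc fuel) {K} lK X⊆K K<fuel with K ≤ᵇ X in K≤X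
    ... | true = trans (ℤΣ.Σ-ind-singleton (λ Y → X ≤ᵇ Y ∧ Y ≤ᵇ K) (μS X) 𝓛 𝓛-unique (InLattice⇒∈𝓛 lX)
                          (cong₂ _∧_ (≤ᵇ-refl X) (≤ᵇ-intro X K X⊆K)) onlyX)
                       (cong (μq q) (ℕP.n∸n≡0 (dimS X)))
      where
      onlyX : ∀ Y → Y ∈ 𝓛 → (X ≤ᵇ Y ∧ Y ≤ᵇ K) ≡ true → Y ≡ X
      onlyX Y Y∈ X≤Y≤K = InLattice-ext (∈𝓛⇒InLattice Y∈) lX
        (≗-by-⊆ (λ v v∈Y → ≤ᵇ-elim K X K≤X v (≤ᵇ-elim Y K (∧-conicalʳ (X ≤ᵇ Y) _ X≤Y≤K) v v∈Y))
                (≤ᵇ-elim X Y (∧-conicalˡ _ _ X≤Y≤K)))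
    ... | false = trans Σμ-via-hyperplane vanish
      where
      witness = ≤ᵇ-false-elim K X K≤X
      hp = hyperplane (InLattice.isSub lX) (InLattice.isSub lK) X⊆K (proj₁ witness) (proj₁ (proj₂ witness)) (proj₂ (proj₂ witness))
      open HyperplaneStep lX lK hp
      open Hyperplane hp using (H; H-isSub; X⊆H; count-K)
      X⊆Hᴸ : ⟦ X ⟧ ⊆ ⟦ Hᴸ ⟧
      X⊆Hᴸ u u∈X = trans (∈Hᴸ u) (X⊆H u u∈X)
      Hᴸ<fuel : count ⟦ Hᴸ ⟧ ℕ.< fuel
      Hᴸ<fuel = begin-strict
        count ⟦ Hᴸ ⟧          ≡⟨ count-cong _ _ ∈Hᴸ ⟩
        count H               <⟨ ℕP.m<n+m (count H) (count-pos H-isSub) ⟩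
        count H ℕ.+ count H   ≡⟨ cong (count H ℕ.+_) (ℕP.+-identityʳ (count H)) ⟨
        2 ℕ.* count H         ≤⟨ ℕP.*-monoˡ-≤ (count H) 2≤q ⟩
        q ℕ.* count H         ≡⟨ count-K ⟨
        count ⟦ K ⟧           ≤⟨ ℕP.≤-pred K<fuel ⟩
        fuel                  ∎
        where open ℕP.≤-Reasoning
      vanish : Σμ X Hᴸ ℤ.+ ℤ.- (+ (q ℕ.^ (h ∸ x))) ℤ.* Σμ X Hᴸ ≡ + 0
      vanish rewrite go fuel lH X⊆Hᴸ Hᴸ<fuel with Hᴸ ≤ᵇ X in H≤X
      ... | false = trans (ℤP.+-identityˡ _) (ℤP.*-zeroʳ (ℤ.- (+ (q ℕ.^ (h ∸ x)))))
      ... | true rewrite InLattice-ext lH lX (≗-by-⊆ (≤ᵇ-elim Hᴸ X H≤X) X⊆Hᴸ) | ℕP.n∸n≡0 x = refl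

-- Bilinear forms and rank-metric codes

module DotProduct (F : FiniteField) where
  open FiniteField F using (_+_; _*_; 0#; 1#)
  open FieldProperties F

  0ᵥ : ∀ n → Vect F n
  0ᵥ n = Vec.replicate n 0#

  dot-+ˡ : ∀ {n} (u u′ v : Vect F n) → dot F (zipWith _+_ u u′) v ≡ (dot F u v + dot F u′ v)
  dot-+ˡ []      []        []      = sym (+-identityˡ 0#)
  dot-+ˡ (x ∷ u) (x′ ∷ u′) (y ∷ v) = trans (cong₂ _+_ (distribʳ y x x′) (dot-+ˡ u u′ v)) (+-interchange _ _ _ _)

  dot-·ˡ : ∀ {n} a (u v : Vect F n) → dot F (Vec.map (a *_) u) v ≡ (a * dot F u v)
  dot-·ˡ a []      []      = sym (zeroʳ a)
  dot-·ˡ a (x ∷ u) (y ∷ v) = trans (cong₂ _+_ (*-assoc a x y) (dot-·ˡ a u v)) (sym (distribˡ a _ _))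

  dot-comm : ∀ {n} (u v : Vect F n) → dot F u v ≡ dot F v u
  dot-comm []      []      = refl
  dot-comm (x ∷ u) (y ∷ v) = cong₂ _+_ (*-comm x y) (dot-comm u v)

  dot-+ʳ : ∀ {n} (u v v′ : Vect F n) → dot F u (zipWith _+_ v v′) ≡ (dot F u v + dot F u v′)
  dot-+ʳ u v v′ = trans (dot-comm u _) (trans (dot-+ˡ v v′ u) (cong₂ _+_ (dot-comm v u) (dot-comm v′ u)))

  dot-·ʳ : ∀ {n} a (u v : Vect F n) → dot F u (Vec.map (a *_) v) ≡ (a * dot F u v)
  dot-·ʳ a u v = trans (dot-comm u _) (trans (dot-·ˡ a v u) (cong (a *_) (dot-comm v u)))

  dot-0ʳ : ∀ {n} (u : Vect F n) → dot F u (0ᵥ n) ≡ 0#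
  dot-0ʳ []      = refl
  dot-0ʳ (x ∷ u) = trans (cong₂ _+_ (zeroʳ x) (dot-0ʳ u)) (+-identityˡ 0#)

  dot-0ˡ : ∀ {n} (u : Vect F n) → dot F (0ᵥ n) u ≡ 0#
  dot-0ˡ u = trans (dot-comm _ u) (dot-0ʳ u)

  -- Test v against the standard basis vectors.
  dot-nondegenerate : ∀ {n} (v : Vect F n) → (∀ u → dot F u v ≡ 0#) → v ≡ 0ᵥ n
  dot-nondegenerate []              _ = refl
  dot-nondegenerate {suc n} (y ∷ v) ⊥v = cong₂ _∷_ y≡0 (dot-nondegenerate v (λ u → trans (sym (tail u)) (⊥v (0# ∷ u))))
    where
    y≡0 : y ≡ 0#
    y≡0 = trans (sym (trans (cong₂ _+_ (*-identityˡ y) (dot-0ˡ v)) (+-identityʳ y))) (⊥v (1# ∷ 0ᵥ n))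
    tail : ∀ u → ((0# * y) + dot F u v) ≡ dot F u v
    tail u = trans (cong (_+ dot F u v) (zeroˡ y)) (+-identityˡ _)

  ·ᵥ-+ : ∀ {n m} (X Y : Mat F n m) y → _·ᵥ_ F (zipWith (zipWith _+_) X Y) y ≡ zipWith _+_ (_·ᵥ_ F X y) (_·ᵥ_ F Y y)
  ·ᵥ-+ []      []      y = refl
  ·ᵥ-+ (r ∷ X) (s ∷ Y) y = cong₂ _∷_ (dot-+ˡ r s y) (·ᵥ-+ X Y y)

  ·ᵥ-scale : ∀ {n m} a (X : Mat F n m) y → _·ᵥ_ F (Vec.map (Vec.map (a *_)) X) y ≡ Vec.map (a *_) (_·ᵥ_ F X y)
  ·ᵥ-scale a []      y = refl
  ·ᵥ-scale a (r ∷ X) y = cong₂ _∷_ (dot-·ˡ a r y) (·ᵥ-scale a X y)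

  ·ᵥ-0ʳ : ∀ {n m} (X : Mat F n m) → _·ᵥ_ F X (0ᵥ m) ≡ 0ᵥ n
  ·ᵥ-0ʳ []      = refl
  ·ᵥ-0ʳ (r ∷ X) = cong₂ _∷_ (dot-0ʳ r) (·ᵥ-0ʳ X)

  ·ᵥ-0ˡ : ∀ {n m} (y : Vect F m) → _·ᵥ_ F (Vec.replicate n (0ᵥ m)) y ≡ 0ᵥ n
  ·ᵥ-0ˡ {zero}  y = refl
  ·ᵥ-0ˡ {suc n} y = cong₂ _∷_ (dot-0ˡ y) (·ᵥ-0ˡ {n} y)

  ·ᵥ-nondegenerate : ∀ {n m} (X : Mat F n m) → (∀ y → _·ᵥ_ F X y ≡ 0ᵥ n) → X ≡ Vec.replicate n (0ᵥ m)
  ·ᵥ-nondegenerate []      _  = refl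
  ·ᵥ-nondegenerate (r ∷ X) X0 =
    cong₂ _∷_ (dot-nondegenerate r (λ y → trans (dot-comm y r) (proj₁ (∷-injective (X0 y)))))
              (·ᵥ-nondegenerate X (λ y → proj₂ (∷-injective (X0 y))))

module RankMetricCode (F : FiniteField) (n m : ℕ) (C : Code F n m) where
  open FiniteField F using (_+_; _*_; 0#; _≟_)
  open FieldProperties F
  open DotProduct F
  open Instances F
  open SubspaceLattice F (FqN F n) (FqN-isFinVectorSpace n)
  open Möbius F (FqN F n) (FqN-isFinVectorSpace n)
  module Mat = FinVectorSpace F (MatSp F n m) (MatSp-isFinVectorSpace n m)

  V : Set
  V = Vect F n

  _·_ : Mat F n m → Vect F m → V
  X · y = _·ᵥ_ F X y

  lker-intro : ∀ B x → (∀ y → dot F x (B · y) ≡ 0#) → ⟦ lker F C B ⟧ x ≡ true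
  lker-intro B x h = trans (mem-filterᵇ _ x) (all-intro _ (allVecs F m) (λ y _ → ≡-does _≟_ (h y)))

  lker-elim : ∀ B x → ⟦ lker F C B ⟧ x ≡ true → ∀ y → dot F x (B · y) ≡ 0#
  lker-elim B x h y = does-≡ _≟_ (all-elim _ (allVecs F m) (trans (sym (mem-filterᵇ _ x)) h) y (allVecs-complete m y))

  perp-intro : ∀ U v → (∀ u → ⟦ U ⟧ u ≡ true → dot F u v ≡ 0#) → ⟦ perp F U ⟧ v ≡ true
  perp-intro U v h = trans (mem-filterᵇ _ v) (all-intro _ U (λ u u∈ → ≡-does _≟_ (h u (mem⁺ U u∈))))

  perp-elim : ∀ U v → ⟦ perp F U ⟧ v ≡ true → ∀ u → ⟦ U ⟧ u ≡ true → dot F u v ≡ 0#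
  perp-elim U v h u u∈ = does-≡ _≟_ (all-elim _ U (trans (sym (mem-filterᵇ _ v)) h) u (mem⁻ U u∈))

  supp-intro : ∀ B y → ⟦ supp F B ⟧ (B · y) ≡ true
  supp-intro B y = trans (mem-filterᵇ _ (B · y)) (any-intro _ (allVecs F m) (allVecs-complete m y) (≡-does (≡-dec _≟_) {B · y} refl))

  supp-elim : ∀ B v → ⟦ supp F B ⟧ v ≡ true → ∃ λ y → B · y ≡ v
  supp-elim B v h with any-elim _ (allVecs F m) (trans (sym (mem-filterᵇ _ v)) h)
  ... | y , _ , By≡v = y , does-≡ (≡-dec _≟_) By≡v

  -- supp(B) ≤ U^⊥ says x · B y = 0 for all x ∈ U and all y, which is U ≤ lker(B).
  supp≤perp≡≤lker : ∀ U B → supp F B ≤ᵇ perp F U ≡ U ≤ᵇ lker F C B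
  supp≤perp≡≤lker U B = ≡-by-⇔ to from
    where
    to : supp F B ≤ᵇ perp F U ≡ true → U ≤ᵇ lker F C B ≡ true
    to h = ≤ᵇ-intro U (lker F C B) (λ u u∈U → lker-intro B u (λ y →
             perp-elim U (B · y) (≤ᵇ-elim (supp F B) (perp F U) h (B · y) (supp-intro B y)) u u∈U))
    from : U ≤ᵇ lker F C B ≡ true → supp F B ≤ᵇ perp F U ≡ true
    from h = ≤ᵇ-intro (supp F B) (perp F U) (λ v v∈ → let (y , By≡v) = supp-elim B v v∈ in
               perp-intro U v (λ u u∈U → subst (λ w → dot F u w ≡ 0#) By≡v (lker-elim B u (≤ᵇ-elim U (lker F C B) h u u∈U) y)))

  lker-isSub : ∀ B → IsSub ⟦ lker F C B ⟧
  lker-isSub B = record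
    { zero∈    = lker-intro B zeroV (λ y → dot-0ˡ (B · y))
    ; +-closed = λ {u} {v} u∈ v∈ → lker-intro B (addV u v) (λ y →
                   trans (dot-+ˡ u v (B · y)) (trans (cong₂ _+_ (lker-elim B u u∈ y) (lker-elim B v v∈ y)) (+-identityˡ 0#)))
    ; ·-closed = λ a {v} v∈ → lker-intro B (scaleV a v) (λ y →
                   trans (dot-·ˡ a v (B · y)) (trans (cong (a *_) (lker-elim B v v∈ y)) (zeroʳ a))) }

  perp-isSub : ∀ U → IsSub ⟦ perp F U ⟧
  perp-isSub U = record
    { zero∈    = perp-intro U zeroV (λ u _ → dot-0ʳ u)
    ; +-closed = λ {v} {w} v∈ w∈ → perp-intro U (addV v w) (λ u u∈ →
                   trans (dot-+ʳ u v w) (trans (cong₂ _+_ (perp-elim U v v∈ u u∈) (perp-elim U w w∈ u u∈)) (+-identityˡ 0#)))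
    ; ·-closed = λ a {v} v∈ → perp-intro U (scaleV a v) (λ u u∈ →
                   trans (dot-·ʳ a u v) (trans (cong (a *_) (perp-elim U v v∈ u u∈)) (zeroʳ a))) }

  perp-InLattice : ∀ U → InLattice (perp F U)
  perp-InLattice U = listOf-InLattice (IsSub-cong (mem-filterᵇ _) (perp-isSub U))

  inAllLker : ∀ {t} → Vec (Mat F n m) t → Pred
  inAllLker bs x = allᵇ (λ B → ⟦ lker F C B ⟧ x) bs

  inAllLker-isSub : ∀ {t} (bs : Vec (Mat F n m) t) → IsSub (inAllLker bs)
  inAllLker-isSub []       = record { zero∈ = refl ; +-closed = λ _ _ → refl ; ·-closed = λ _ _ → refl }
  inAllLker-isSub (B ∷ bs) = record
    { zero∈    = cong₂ _∧_ (IsSub.zero∈ (lker-isSub B)) (IsSub.zero∈ (inAllLker-isSub bs))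
    ; +-closed = λ {u} {v} u∈ v∈ → cong₂ _∧_
        (IsSub.+-closed (lker-isSub B) {u} {v} (∧-conicalˡ _ _ u∈) (∧-conicalˡ _ _ v∈))
        (IsSub.+-closed (inAllLker-isSub bs) {u} {v} (∧-conicalʳ (⟦ lker F C B ⟧ u) _ u∈) (∧-conicalʳ (⟦ lker F C B ⟧ v) _ v∈))
    ; ·-closed = λ a {v} v∈ → cong₂ _∧_
        (IsSub.·-closed (lker-isSub B) a {v} (∧-conicalˡ _ _ v∈))
        (IsSub.·-closed (inAllLker-isSub bs) a {v} (∧-conicalʳ (⟦ lker F C B ⟧ v) _ v∈)) }

  lkerInter-InLattice : ∀ {t} (bs : Vec (Mat F n m) t) → InLattice (lkerInter F C bs)
  lkerInter-InLattice bs = listOf-InLattice (inAllLker-isSub bs)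

  ≤ᵇ-lkerInter-∷ : ∀ U {t} B (bs : Vec (Mat F n m) t) →
    U ≤ᵇ lkerInter F C (B ∷ bs) ≡ (U ≤ᵇ lker F C B ∧ U ≤ᵇ lkerInter F C bs)
  ≤ᵇ-lkerInter-∷ U B bs = ≡-by-⇔ to from
    where
    ∈lkerInter : ∀ {t} (bs : Vec (Mat F n m) t) v → ⟦ lkerInter F C bs ⟧ v ≡ inAllLker bs v
    ∈lkerInter bs = mem-filterᵇ (inAllLker bs)
    to : U ≤ᵇ lkerInter F C (B ∷ bs) ≡ true → (U ≤ᵇ lker F C B ∧ U ≤ᵇ lkerInter F C bs) ≡ true
    to h = cong₂ _∧_ (≤ᵇ-intro U (lker F C B) (λ v v∈ → ∧-conicalˡ _ _ (inBoth v v∈)))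
                     (≤ᵇ-intro U (lkerInter F C bs) (λ v v∈ → trans (∈lkerInter bs v) (∧-conicalʳ (⟦ lker F C B ⟧ v) _ (inBoth v v∈))))
      where
      inBoth : ∀ v → ⟦ U ⟧ v ≡ true → inAllLker (B ∷ bs) v ≡ true
      inBoth v v∈ = trans (sym (∈lkerInter (B ∷ bs) v)) (≤ᵇ-elim U (lkerInter F C (B ∷ bs)) h v v∈)
    from : (U ≤ᵇ lker F C B ∧ U ≤ᵇ lkerInter F C bs) ≡ true → U ≤ᵇ lkerInter F C (B ∷ bs) ≡ true
    from h = ≤ᵇ-intro U (lkerInter F C (B ∷ bs)) (λ v v∈ → trans (∈lkerInter (B ∷ bs) v)
               (cong₂ _∧_ (≤ᵇ-elim U (lker F C B) (∧-conicalˡ _ _ h) v v∈)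
                          (trans (sym (∈lkerInter bs v)) (≤ᵇ-elim U (lkerInter F C bs) (∧-conicalʳ (U ≤ᵇ lker F C B) _ h) v v∈))))

  supp-zero : ∀ B → ⟦ supp F B ⟧ zeroV ≡ true
  supp-zero B = subst (λ w → ⟦ supp F B ⟧ w ≡ true) (·ᵥ-0ʳ B) (supp-intro B (0ᵥ m))

  sumSub-zero : ∀ Us → (∀ U → U ∈ Us → ⟦ U ⟧ zeroV ≡ true) → ⟦ sumSub F Us ⟧ zeroV ≡ true
  sumSub-zero []       _  = mem⁺ (zeroV ∷ []) (here refl)
  sumSub-zero (U ∷ Us) 0∈ = trans (mem-filterᵇ _ zeroV)
    (any-intro _ U (mem⁻ U (0∈ U (here refl)))
      (subst (λ w → ⟦ sumSub F Us ⟧ w ≡ true) (sym (subV-self zeroV)) (sumSub-zero Us (λ U′ U′∈ → 0∈ U′ (there U′∈)))))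

  sumSub-⊇ : ∀ Us → (∀ U → U ∈ Us → ⟦ U ⟧ zeroV ≡ true) → ∀ U → U ∈ Us → ⟦ U ⟧ ⊆ ⟦ sumSub F Us ⟧
  sumSub-⊇ (U ∷ Us) 0∈ .U (here refl) v v∈U = trans (mem-filterᵇ _ v)
    (any-intro _ U (mem⁻ U v∈U)
      (subst (λ w → ⟦ sumSub F Us ⟧ w ≡ true) (sym (subV-self v)) (sumSub-zero Us (λ U′ U′∈ → 0∈ U′ (there U′∈)))))
  sumSub-⊇ (U′ ∷ Us) 0∈ U (there U∈) v v∈U = trans (mem-filterᵇ _ v)
    (any-intro _ U′ (mem⁻ U′ (0∈ U′ (here refl)))
      (subst (λ w → ⟦ sumSub F Us ⟧ w ≡ true) (sym v-0≡v) (sumSub-⊇ Us (λ U″ U″∈ → 0∈ U″ (there U″∈)) U U∈ v v∈U)))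
    where
    v-0≡v : subV F (FqN F n) v zeroV ≡ v
    v-0≡v = trans (cong (addV v) (·-zeroʳ _)) (+ᵥ-identityʳ v)

  induced : Mat F n m → Bool
  induced = InducedByᵇ F C

  supp⊆suppC : ∀ B → induced B ≡ true → ⟦ supp F B ⟧ ⊆ ⟦ suppC F C ⟧
  supp⊆suppC B B∈C = sumSub-⊇ (map (supp F) (codewords C)) supp∋0 (supp F B)
                       (∈-map⁺ (supp F) (memBy⁻ (FinSpace.eqV (MatSp F n m)) {B} B∈C))
    where
    supp∋0 : ∀ U → U ∈ map (supp F) (codewords C) → ⟦ U ⟧ zeroV ≡ true
    supp∋0 U U∈ with ∈-map⁻ (supp F) U∈
    ... | X , _ , refl = supp-zero X

  suppC⊥⊆lker : ∀ B → induced B ≡ true → ⟦ perp F (suppC F C) ⟧ ⊆ ⟦ lker F C B ⟧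
  suppC⊥⊆lker B B∈C x x⊥ = lker-intro B x (λ y → trans (dot-comm x (B · y))
    (perp-elim (suppC F C) x x⊥ (B · y) (supp⊆suppC B B∈C (B · y) (supp-intro B y))))

  suppC⊥⊆lkerInter : ∀ {t} (bs : Vec (Mat F n m) t) → allᵇ induced bs ≡ true →
    ⟦ perp F (suppC F C) ⟧ ⊆ ⟦ lkerInter F C bs ⟧
  suppC⊥⊆lkerInter bs bs∈C x x⊥ = trans (mem-filterᵇ (inAllLker bs) x) (inAll bs bs∈C)
    where
    inAll : ∀ {t} (bs : Vec (Mat F n m) t) → allᵇ induced bs ≡ true → inAllLker bs x ≡ true
    inAll []       _      = refl
    inAll (B ∷ bs) bs∈C = cong₂ _∧_ (suppC⊥⊆lker B (∧-conicalˡ _ _ bs∈C) x x⊥) (inAll bs (∧-conicalʳ (induced B) _ bs∈C))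

  MatS : FinSpace F (Mat F n m)
  MatS = MatSp F n m

  0ₘ : Mat F n m
  0ₘ = FinSpace.zeroV MatS

  allMats : List (Mat F n m)
  allMats = FinSpace.allV MatS

  restricts : List V → Mat F n m → Bool
  restricts U B = supp F B ≤ᵇ perp F U

  lker-0 : ∀ x → ⟦ lker F C 0ₘ ⟧ x ≡ true
  lker-0 x = lker-intro 0ₘ x (λ y → trans (cong (dot F x) (·ᵥ-0ˡ {n} y)) (dot-0ʳ x))

  lker-+ : ∀ X Y x → ⟦ lker F C X ⟧ x ≡ true → ⟦ lker F C Y ⟧ x ≡ true → ⟦ lker F C (FinSpace.addV MatS X Y) ⟧ x ≡ true
  lker-+ X Y x x∈X x∈Y = lker-intro _ x (λ y → begin
    dot F x (FinSpace.addV MatS X Y · y)           ≡⟨ cong (dot F x) (·ᵥ-+ X Y y) ⟩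
    dot F x (Vec.zipWith _+_ (X · y) (Y · y))      ≡⟨ dot-+ʳ x (X · y) (Y · y) ⟩
    (dot F x (X · y) + dot F x (Y · y))            ≡⟨ cong₂ _+_ (lker-elim X x x∈X y) (lker-elim Y x x∈Y y) ⟩
    (0# + 0#)                                      ≡⟨ +-identityˡ 0# ⟩
    0#                                             ∎)
    where open ≡-Reasoning

  lker-· : ∀ a X x → ⟦ lker F C X ⟧ x ≡ true → ⟦ lker F C (FinSpace.scaleV MatS a X) ⟧ x ≡ true
  lker-· a X x x∈X = lker-intro _ x (λ y →
    trans (cong (dot F x) (·ᵥ-scale a X y)) (trans (dot-·ʳ a x (X · y)) (trans (cong (a *_) (lker-elim X x x∈X y)) (zeroʳ a))))

  restricts-lker : ∀ U B → restricts U B ≡ true → ⟦ U ⟧ ⊆ ⟦ lker F C B ⟧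
  restricts-lker U B h = ≤ᵇ-elim U (lker F C B) (trans (sym (supp≤perp≡≤lker U B)) h)

  lker-restricts : ∀ U B → ⟦ U ⟧ ⊆ ⟦ lker F C B ⟧ → restricts U B ≡ true
  lker-restricts U B h = trans (supp≤perp≡≤lker U B) (≤ᵇ-intro U (lker F C B) h)

  Crestr-IsSubspace : ∀ U → IsSubspace F MatS (Crestr F C U)
  Crestr-IsSubspace U = record
    { nodup   = filterᵇ-unique (restricts U) (IsSubspace.nodup C-sub)
    ; hasZero = ∈-filterᵇ⁺ (restricts U) (IsSubspace.hasZero C-sub) (lker-restricts U 0ₘ (λ x _ → lker-0 x))
    ; closed+ = λ {X} {Y} X∈ Y∈ → ∈-filterᵇ⁺ (restricts U) (IsSubspace.closed+ C-sub (∈C X∈) (∈C Y∈))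
                  (lker-restricts U _ (λ x x∈U → lker-+ X Y x (restricts-lker U X (res X∈) x x∈U) (restricts-lker U Y (res Y∈) x x∈U)))
    ; closed· = λ a {X} X∈ → ∈-filterᵇ⁺ (restricts U) (IsSubspace.closed· C-sub a (∈C X∈))
                  (lker-restricts U _ (λ x x∈U → lker-· a X x (restricts-lker U X (res X∈) x x∈U))) }
    where
    C-sub = isSubspace C
    ∈C : ∀ {X} → X ∈ Crestr F C U → X ∈ codewords C
    ∈C {X} X∈ = proj₁ (∈-filterᵇ⁻ (restricts U) {X} {codewords C} X∈)
    res : ∀ {X} → X ∈ Crestr F C U → restricts U X ≡ true
    res {X} X∈ = proj₂ (∈-filterᵇ⁻ (restricts U) {X} {codewords C} X∈)

  dimC : List V → ℕ
  dimC U = dim F MatS (Crestr F C U)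

  length-Crestr : ∀ U → length (Crestr F C U) ≡ q ℕ.^ dimC U
  length-Crestr U = Mat.length≡q^dim (Crestr F C U) (Crestr-IsSubspace U)

  length-Crestr≡count : ∀ U → length (Crestr F C U) ≡ ℕΣ.Σ (λ B → ℕΣ.ind (induced B ∧ restricts U B) 1) allMats
  length-Crestr≡count U = trans (Mat.length≡count-mem (Crestr F C U) (IsSubspace.nodup (Crestr-IsSubspace U)))
    (Mat.count-cong _ _ (λ B → memBy-filterᵇ (FinSpace.eqV MatS) (restricts U) B (codewords C)))

  dimC≤k : ∀ U → dimC U ℕ.≤ k F C
  dimC≤k U = q^-reflect-≤ (subst₂ ℕ._≤_ (length-Crestr U) (Mat.length≡q^dim (codewords C) (isSubspace C))
                                      (length-filter (T? ∘ restricts U) (codewords C)))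

  -- Only the zero matrix has its support inside E^⊥ = 0.
  restricts-E : ∀ B → (induced B ∧ restricts (E F C) B) ≡ does (FinSpace.eqV MatS B 0ₘ)
  restricts-E B = ≡-by-⇔ to from
    where
    to : (induced B ∧ restricts (E F C) B) ≡ true → does (FinSpace.eqV MatS B 0ₘ) ≡ true
    to h = ≡-does (FinSpace.eqV MatS) (·ᵥ-nondegenerate B (λ y → dot-nondegenerate (B · y) (λ u →
             lker-elim B u (restricts-lker (E F C) B (∧-conicalʳ (induced B) _ h) u (mem⁺ allV (allV-complete u))) y)))
    from : does (FinSpace.eqV MatS B 0ₘ) ≡ true → (induced B ∧ restricts (E F C) B) ≡ true
    from h rewrite does-≡ (FinSpace.eqV MatS) {B} {0ₘ} h =
      cong₂ _∧_ (memBy⁺ (FinSpace.eqV MatS) (IsSubspace.hasZero (isSubspace C))) (lker-restricts (E F C) 0ₘ (λ x _ → lker-0 x))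

  dimC-E : dimC (E F C) ≡ 0
  dimC-E = q^-injective (begin
    q ℕ.^ dimC (E F C)                                                   ≡⟨ length-Crestr (E F C) ⟨
    length (Crestr F C (E F C))                                          ≡⟨ length-Crestr≡count (E F C) ⟩
    ℕΣ.Σ (λ B → ℕΣ.ind (induced B ∧ restricts (E F C) B) 1) allMats      ≡⟨ ℕΣ.Σ-cong allMats (λ B → cong (λ b → ℕΣ.ind b 1) (restricts-E B)) ⟩
    ℕΣ.Σ (λ B → ℕΣ.ind (does (FinSpace.eqV MatS B 0ₘ)) 1) allMats        ≡⟨ ℕΣ.Universe.Σ-ind-≡ (FinSpace.eqV MatS) allMats Mat.allV-unique Mat.allV-complete (λ _ → 1) 0ₘ ⟩
    1                                                                    ∎)
    where open ≡-Reasoning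

  ρE∸ρ≡dimC : ∀ U → ρ F C (E F C) ∸ ρ F C U ≡ dimC U
  ρE∸ρ≡dimC U = trans (cong (λ d → (k F C ∸ d) ∸ (k F C ∸ dimC U)) dimC-E) (ℕP.m∸[m∸n]≡n (dimC≤k U))

  allᵇ-restricts : ∀ U {t} (bs : Vec (Mat F n m) t) →
    allᵇ (λ B → induced B ∧ restricts U B) bs ≡ (allᵇ induced bs ∧ U ≤ᵇ lkerInter F C bs)
  allᵇ-restricts U []       = sym (≤ᵇ-intro U (lkerInter F C []) (λ v _ → mem-filterᵇ (inAllLker []) v))
  allᵇ-restricts U (B ∷ bs) = begin
    (induced B ∧ restricts U B) ∧ allᵇ (λ B → induced B ∧ restricts U B) bs
      ≡⟨ cong₂ (λ x y → (induced B ∧ x) ∧ y) (supp≤perp≡≤lker U B) (allᵇ-restricts U bs) ⟩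
    (induced B ∧ U ≤ᵇ lker F C B) ∧ (allᵇ induced bs ∧ U ≤ᵇ lkerInter F C bs)
      ≡⟨ ∧-interchange (induced B) _ _ _ ⟩
    (induced B ∧ allᵇ induced bs) ∧ (U ≤ᵇ lker F C B ∧ U ≤ᵇ lkerInter F C bs)
      ≡⟨ cong ((induced B ∧ allᵇ induced bs) ∧_) (≤ᵇ-lkerInter-∷ U B bs) ⟨
    (induced B ∧ allᵇ induced bs) ∧ U ≤ᵇ lkerInter F C (B ∷ bs) ∎
    where open ≡-Reasoning

  tuples : (t : ℕ) → List (Vec (Mat F n m) t)
  tuples t = allVecsOf allMats t

  -- (q^t)^(dim C_U) = |C_U|^t counts the t-tuples from C whose left kernels all contain U.
  q^t^ρ-gap : ∀ t U → (+ (q ℕ.^ t)) ^ℤ (ρ F C (E F C) ∸ ρ F C U)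
                    ≡ ℤΣ.Σ (λ bs → ℤΣ.ind (allᵇ induced bs ∧ U ≤ᵇ lkerInter F C bs) (+ 1)) (tuples t)
  q^t^ρ-gap t U = begin
    (+ (q ℕ.^ t)) ^ℤ (ρ F C (E F C) ∸ ρ F C U)
      ≡⟨ cong ((+ (q ℕ.^ t)) ^ℤ_) (ρE∸ρ≡dimC U) ⟩
    (+ (q ℕ.^ t)) ^ℤ dimC U
      ≡⟨ +-^ℤ (q ℕ.^ t) (dimC U) ⟩
    + ((q ℕ.^ t) ℕ.^ dimC U)
      ≡⟨ cong +_ (trans (ℕP.^-*-assoc q t (dimC U)) (trans (cong (q ℕ.^_) (ℕP.*-comm t (dimC U))) (sym (ℕP.^-*-assoc q (dimC U) t)))) ⟩
    + ((q ℕ.^ dimC U) ℕ.^ t)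
      ≡⟨ cong (λ c → + (c ℕ.^ t)) (trans (sym (length-Crestr U)) (length-Crestr≡count U)) ⟩
    + (ℕΣ.Σ (λ B → ℕΣ.ind (induced B ∧ restricts U B) 1) allMats ℕ.^ t)
      ≡⟨ cong +_ (count-tuples (λ B → induced B ∧ restricts U B) allMats t) ⟨
    + ℕΣ.Σ (λ bs → ℕΣ.ind (allᵇ (λ B → induced B ∧ restricts U B) bs) 1) (tuples t)
      ≡⟨ +-Σ _ (tuples t) ⟩
    ℤΣ.Σ (λ bs → + ℕΣ.ind (allᵇ (λ B → induced B ∧ restricts U B) bs) 1) (tuples t)
      ≡⟨ ℤΣ.Σ-cong (tuples t) (λ bs → trans (+-ind _) (cong (λ b → ℤΣ.ind b (+ 1)) (allᵇ-restricts U bs))) ⟩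
    ℤΣ.Σ (λ bs → ℤΣ.ind (allᵇ induced bs ∧ U ≤ᵇ lkerInter F C bs) (+ 1)) (tuples t) ∎
    where open ≡-Reasoning

  suppC⊥ : List V
  suppC⊥ = perp F (suppC F C)

  charPoly-expand : ∀ z → charPoly F C suppC⊥ (E F C) z
    ≡ ℤΣ.Σ (λ A → ℤΣ.ind (suppC⊥ ≤ᵇ A ∧ A ≤ᵇ E F C) (μS suppC⊥ A ℤ.* (z ^ℤ (ρ F C (E F C) ∸ ρ F C A)))) 𝓛
  charPoly-expand z = trans (sumℤ≡Σ term (filterᵇ inInterval 𝓛)) (ℤΣ.Σ-filterᵇ term inInterval 𝓛)
    where
    inInterval : List V → Bool
    inInterval A = suppC⊥ ≤ᵇ A ∧ A ≤ᵇ E F C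
    term : List V → ℤ
    term A = μS suppC⊥ A ℤ.* (z ^ℤ (ρ F C (E F C) ∸ ρ F C A))

  countDistinguishing-as-Σμ : ∀ t → + countDistinguishing F C t (suppC F C)
    ≡ ℤΣ.Σ (λ bs → ℤΣ.ind (allᵇ induced bs) (Σμ suppC⊥ (lkerInter F C bs))) (tuples t)
  countDistinguishing-as-Σμ t = begin
    + length (filterᵇ distinguishing (tuples t))
      ≡⟨ cong +_ (trans (length≡Σ1 (filterᵇ distinguishing (tuples t))) (ℕΣ.Σ-filterᵇ (λ _ → 1) distinguishing (tuples t))) ⟩
    + ℕΣ.Σ (λ bs → ℕΣ.ind (distinguishing bs) 1) (tuples t)
      ≡⟨ trans (+-Σ _ (tuples t)) (ℤΣ.Σ-cong (tuples t) (λ bs → +-ind (distinguishing bs))) ⟩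
    ℤΣ.Σ (λ bs → ℤΣ.ind (distinguishing bs) (+ 1)) (tuples t)
      ≡⟨ ℤΣ.Σ-cong (tuples t) Möbius-inversion ⟨
    ℤΣ.Σ (λ bs → ℤΣ.ind (allᵇ induced bs) (Σμ suppC⊥ (lkerInter F C bs))) (tuples t) ∎
    where
    open ≡-Reasoning
    distinguishing : ∀ {t} → Vec (Mat F n m) t → Bool
    distinguishing bs = allᵇ induced bs ∧ distinguishesᵇ F C bs (suppC F C)
    Möbius-inversion : ∀ {t} (bs : Vec (Mat F n m) t) →
      ℤΣ.ind (allᵇ induced bs) (Σμ suppC⊥ (lkerInter F C bs)) ≡ ℤΣ.ind (distinguishing bs) (+ 1)
    Möbius-inversion bs with allᵇ induced bs in bs∈C
    ... | false = refl
    ... | true  = Σμ-interval (perp-InLattice (suppC F C)) (lkerInter-InLattice bs) (suppC⊥⊆lkerInter bs bs∈C)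

  countDistinguishing≡charPolyContr : ∀ t → + countDistinguishing F C t (suppC F C) ≡ charPolyContr F C (suppC F C) (+ (q ℕ.^ t))
  countDistinguishing≡charPolyContr t = sym (begin
    charPoly F C suppC⊥ (E F C) z
      ≡⟨ charPoly-expand z ⟩
    ℤΣ.Σ (λ A → ℤΣ.ind (inInterval A) (μS suppC⊥ A ℤ.* (z ^ℤ (ρ F C (E F C) ∸ ρ F C A)))) 𝓛
      ≡⟨ ℤΣ.Σ-cong 𝓛 expandPower ⟩
    ℤΣ.Σ (λ A → ℤΣ.Σ (λ bs → ℤΣ.ind (inInterval A) (ℤΣ.ind (allᵇ induced bs ∧ A ≤ᵇ lkerInter F C bs) (μS suppC⊥ A))) (tuples t)) 𝓛
      ≡⟨ ℤΣ.Σ-swap _ 𝓛 (tuples t) ⟩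
    ℤΣ.Σ (λ bs → ℤΣ.Σ (λ A → ℤΣ.ind (inInterval A) (ℤΣ.ind (allᵇ induced bs ∧ A ≤ᵇ lkerInter F C bs) (μS suppC⊥ A))) 𝓛) (tuples t)
      ≡⟨ ℤΣ.Σ-cong (tuples t) regroup ⟩
    ℤΣ.Σ (λ bs → ℤΣ.ind (allᵇ induced bs) (Σμ suppC⊥ (lkerInter F C bs))) (tuples t)
      ≡⟨ countDistinguishing-as-Σμ t ⟨
    + countDistinguishing F C t (suppC F C) ∎)
    where
    open ≡-Reasoning
    z = + (q ℕ.^ t)
    inInterval : List V → Bool
    inInterval A = suppC⊥ ≤ᵇ A ∧ A ≤ᵇ E F C
    expandPower : ∀ A → ℤΣ.ind (inInterval A) (μS suppC⊥ A ℤ.* (z ^ℤ (ρ F C (E F C) ∸ ρ F C A)))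
      ≡ ℤΣ.Σ (λ bs → ℤΣ.ind (inInterval A) (ℤΣ.ind (allᵇ induced bs ∧ A ≤ᵇ lkerInter F C bs) (μS suppC⊥ A))) (tuples t)
    expandPower A = trans (cong (ℤΣ.ind (inInterval A)) (trans (cong (μS suppC⊥ A ℤ.*_) (q^t^ρ-gap t A))
                            (trans (sym (ℤΣ.Σ-⊗ˡ (μS suppC⊥ A) _ (tuples t)))
                                   (ℤΣ.Σ-cong (tuples t) (λ bs → ℤΣ.⊗-ind𝟙 (μS suppC⊥ A) _)))))
                          (ℤΣ.ind-Σ (inInterval A) _ (tuples t))
    A≤E : ∀ A → A ≤ᵇ E F C ≡ true
    A≤E A = ≤ᵇ-intro A (E F C) (λ u _ → mem⁺ allV (allV-complete u))
    reorder : ∀ x e a s (μ : ℤ) → e ≡ true → ℤΣ.ind (x ∧ e) (ℤΣ.ind (a ∧ s) μ) ≡ ℤΣ.ind a (ℤΣ.ind (x ∧ s) μ)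
    reorder true  true true  s μ refl = refl
    reorder true  true false s μ refl = refl
    reorder false true true  s μ refl = refl
    reorder false true false s μ refl = refl
    regroup : ∀ bs → ℤΣ.Σ (λ A → ℤΣ.ind (inInterval A) (ℤΣ.ind (allᵇ induced bs ∧ A ≤ᵇ lkerInter F C bs) (μS suppC⊥ A))) 𝓛
                   ≡ ℤΣ.ind (allᵇ induced bs) (Σμ suppC⊥ (lkerInter F C bs))
    regroup bs = trans (ℤΣ.Σ-cong 𝓛 (λ A → reorder (suppC⊥ ≤ᵇ A) (A ≤ᵇ E F C) (allᵇ induced bs) (A ≤ᵇ lkerInter F C bs) _ (A≤E A)))
                       (sym (ℤΣ.ind-Σ (allᵇ induced bs) _ 𝓛))

  suppC⊥≡zeroSpace : NonDegenerate F C → suppC⊥ ≡ zeroSpace F C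
  suppC⊥≡zeroSpace nonDeg = unique-singleton suppC⊥ (filterᵇ-unique _ allV-unique)
    (mem⁻ suppC⊥ (IsSub.zero∈ (perp-isSub (suppC F C))))
    (λ y y∈ → dot-nondegenerate y (λ u → perp-elim (suppC F C) y (mem⁺ suppC⊥ y∈) u (mem⁺ (suppC F C) (nonDeg u))))

corollary4p5 : (F : FiniteField) (n m : ℕ) (C : Code F n m) (t : ℕ) →
    (+ countDistinguishing F C t (suppC F C)
        ≡ charPolyContr F C (suppC F C) (+ (card F ^ t)))
    × (NonDegenerate F C →
        + countDistinguishing F C t (suppC F C) ≡ charPolyM F C (+ (card F ^ t)))
corollary4p5 F n m C t =
  countDistinguishing≡charPolyContr t ,
  λ nonDeg → trans (countDistinguishing≡charPolyContr t) (cong (λ X → charPoly F C X (E F C) (+ (card F ^ t))) (suppC⊥≡zeroSpace nonDeg))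
  where open RankMetricCode F n m C
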